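{- Let $q$ and $s$ be indeterminates and consider linear operators on the space of polynomials in $x$ (with coefficients rational functions in $q,s$). Let $X$ be multiplication by $x$, i.e. $Xf(x)=xf(x)$, and let $D_q$ be the $q$-differentiation operator $D_qf(x)=\frac{f(qx)-f(x)}{(q-1)x}$. For a polynomial $g(x)$, let $g(X)$ denote the operator of multiplication by $g(x)$. Then for every $n\ge 0$, $$(X+q^{n-1}sD_q)(X+q^{n-2}sD_q)\cdots(X+sD_q)=\sum_{k=0}^n g_n(k,X,s)\,s^kD_q^k,$$ where $$g_n(k,x,s)=\begin{bmatrix} n\\ k\end{bmatrix}\sum_{j=0}^{\lfloor (n-k)/2\rfloor} s^j q^{j^2+kj+\binom{k}{2}}\begin{bmatrix} n-k\\ 2j\end{bmatrix}[2j-1]!!\prod_{i=0}^{k-1}\frac{1+q^{n-j-i}}{1+q^{j+1+i}}\,x^{n-k-2j}.$$ In particular, for $k=0$, $g_n(0,x,s)=h_n(x,s)$, where $$h_n(x,s)=\sum_{j=0}^{\lfloor n/2\rfloor} q^{j^2}s^j\frac{[n]!}{(1+q)(1+q^2)\cdots(1+q^j)\,[j]!\,[n-2j]!}x^{n-2j}.$$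
   Context: Notation: $[n]=\frac{1-q^n}{1-q}=1+q+\cdots+q^{n-1}$, $[n]!=[1][2]\cdots[n]$ with $[0]!=1$, and $\begin{bmatrix} n\\ k\end{bmatrix}=\frac{[n]!}{[k]![n-k]!}$ is the $q$-binomial (Gaussian) coefficient. Also $[2j-1]!!=[1][3]\cdots[2j-1]$ (equal to $1$ for $j=0$), so that $\begin{bmatrix} n\\ 2j\end{bmatrix}[2j-1]!!=\frac{[n]!}{(1+q)(1+q^2)\cdots(1+q^j)[j]![n-2j]!}$. $\binom{k}{2}=k(k-1)/2$ is the ordinary binomial coefficient. -}

module Defs where

open import Data.Nat using (ℕ; zero; suc; _+_; _*_; _∸_; ⌊_/2⌋)
open import Data.Nat.Combinatorics using (_C_)
import Data.Integer as ℤ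
open ℤ using (ℤ)
open import Data.List using (List; []; _∷_; _++_)
open import Data.Product using (Σ; _,_)
open import Relation.Binary.PropositionalEquality using (_≡_; _≢_)
open import Relation.Nullary using (¬_)

-- Dense univariate polynomials over a carrier A (coefficient lists,
-- lowest degree first), with equality "same coefficients" (so trailing
-- zeros do not matter), computed from the given operations on A.

module PolyOps {A : Set} (0a 1a : A) (_+a_ _*a_ : A → A → A) (-a_ : A → A)
               (_≈a_ : A → A → Set) where

  Poly : Set
  Poly = List A

  zeroP : Poly
  zeroP = []

  oneP : Poly
  oneP = 1a ∷ []

  constP : A → Poly
  constP a = a ∷ []

  infixl 6 _⊕_
  infixl 7 _⊗_
  infix 4 _≋_

  _⊕_ : Poly → Poly → Poly
  [] ⊕ ys = ys
  (x ∷ xs) ⊕ [] = x ∷ xs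
  (x ∷ xs) ⊕ (y ∷ ys) = (x +a y) ∷ (xs ⊕ ys)

  neg : Poly → Poly
  neg [] = []
  neg (x ∷ xs) = (-a x) ∷ neg xs

  scale : A → Poly → Poly
  scale c [] = []
  scale c (y ∷ ys) = (c *a y) ∷ scale c ys

  _⊗_ : Poly → Poly → Poly
  [] ⊗ ys = []
  (x ∷ xs) ⊗ ys = scale x ys ⊕ (0a ∷ (xs ⊗ ys))

  var : Poly
  var = 0a ∷ 1a ∷ []

  shift : Poly → Poly
  shift p = 0a ∷ p

  varPow : ℕ → Poly
  varPow zero = oneP
  varPow (suc m) = shift (varPow m)

  coeff : Poly → ℕ → A
  coeff [] _ = 0a
  coeff (x ∷ xs) zero = x
  coeff (x ∷ xs) (suc i) = coeff xs i

  _≋_ : Poly → Poly → Set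
  p ≋ r = ∀ i → coeff p i ≈a coeff r i

module P1 = PolyOps (ℤ.+ 0) (ℤ.+ 1) ℤ._+_ ℤ._*_ ℤ.-_ _≡_   -- polynomials in s
module P2 = PolyOps P1.zeroP P1.oneP P1._⊕_ P1._⊗_ P1.neg P1._≋_  -- polynomials in q over ℤ[s]

Poly2 : Set
Poly2 = P2.Poly

NZ : Set
NZ = Σ Poly2 (λ p → ¬ (p P2.≋ P2.zeroP))

nzC00 : (p : Poly2) → P1.coeff (P2.coeff p 0) 0 ≢ ℤ.+ 0 → ¬ (p P2.≋ P2.zeroP)
nzC00 p h eq = h (eq 0 0)

-- The field K = ℚ(q,s) = Frac(ℤ[q,s]).  An element is a numerator
-- together with a list of nonzero denominator factors; its value is
-- num / (product of the factors).

record K : Set where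
  constructor _/_
  field
    num  : Poly2
    dens : List NZ
open K public

denProd : List NZ → Poly2
denProd [] = P2.oneP
denProd ((d , _) ∷ ds) = d P2.⊗ denProd ds

embed : Poly2 → K
embed p = p / []

0K : K
0K = P2.zeroP / []

1K : K
1K = P2.oneP / []

infixl 6 _+K_
infixl 7 _*K_
infix 4 _≈K_

_+K_ : K → K → K
x +K y = ((num x P2.⊗ denProd (dens y)) P2.⊕ (num y P2.⊗ denProd (dens x))) / (dens x ++ dens y)

_*K_ : K → K → K
x *K y = (num x P2.⊗ num y) / (dens x ++ dens y)

-K_ : K → K
-K x = P2.neg (num x) / dens x

_≈K_ : K → K → Set
x ≈K y = (num x P2.⊗ denProd (dens y)) P2.≋ (num y P2.⊗ denProd (dens x))

divK : K → NZ → K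
divK (a / ds) d = a / (d ∷ ds)

powK : K → ℕ → K
powK x zero = 1K
powK x (suc m) = powK x m *K x

qK : K
qK = embed P2.var

sK : K
sK = embed (P2.constP P1.var)

-- [n] = 1 + q + ... + q^(n-1)   (written in Horner form 1 + q·[n-1])
qnum : ℕ → Poly2
qnum zero = P2.zeroP
qnum (suc n) = P2.oneP P2.⊕ P2.shift (qnum n)

-- [n+1] as a nonzero polynomial
qnumNZ : ℕ → NZ
qnumNZ n = qnum (suc n) , nzC00 (qnum (suc n)) (λ ())

qfact : ℕ → Poly2
qfact zero = P2.oneP
qfact (suc n) = qfact n P2.⊗ qnum (suc n)

qfactNZs : ℕ → List NZ
qfactNZs zero = []
qfactNZs (suc n) = qfactNZs n ++ (qnumNZ n ∷ [])

-- Gaussian binomial [n choose k] = [n]! / ([k]! [n-k]!)  (used for k ≤ n)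
qbinK : ℕ → ℕ → K
qbinK n k = qfact n / (qfactNZs k ++ qfactNZs (n ∸ k))

-- [2j-1]!! = [1][3]...[2j-1]
oddFact : ℕ → Poly2
oddFact zero = P2.oneP
oddFact (suc j) = oddFact j P2.⊗ qnum (2 * j + 1)

onePlusQ : ℕ → Poly2
onePlusQ m = P2.oneP P2.⊕ P2.varPow m

onePlusQNZ : ℕ → NZ
onePlusQNZ zero = onePlusQ zero , nzC00 (onePlusQ zero) (λ ())
onePlusQNZ (suc m) = onePlusQ (suc m) , nzC00 (onePlusQ (suc m)) (λ ())

onePlusQNZs : ℕ → List NZ
onePlusQNZs zero = []
onePlusQNZs (suc j) = onePlusQNZs j ++ (onePlusQNZ (suc j) ∷ [])

qMinus1NZ : NZ
qMinus1NZ = (P2.var P2.⊕ P2.neg P2.oneP) , nzC00 (P2.var P2.⊕ P2.neg P2.oneP) (λ ())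

prodK : ℕ → (ℕ → K) → K
prodK zero f = 1K
prodK (suc k) f = prodK k f *K f k

module PX = PolyOps 0K 1K _+K_ _*K_ -K_ _≈K_

KPoly : Set
KPoly = PX.Poly

infix 4 _≈X_

_≈X_ : KPoly → KPoly → Set
_≈X_ = PX._≋_

-- Σ_{j=0}^{m} f j   (upper bound inclusive)
sumTo : ℕ → (ℕ → KPoly) → KPoly
sumTo zero f = f 0
sumTo (suc m) f = sumTo m f PX.⊕ f (suc m)

-- f(c x):  coefficient a_m of x^m becomes a_m c^m
argScaleFrom : K → ℕ → KPoly → KPoly
argScaleFrom c m [] = []
argScaleFrom c m (a ∷ as) = (a *K powK c m) ∷ argScaleFrom c (suc m) as

argScale : K → KPoly → KPoly
argScale c f = argScaleFrom c 0 f

-- division by x of a polynomial whose constant term is zero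
divX : KPoly → KPoly
divX [] = []
divX (_ ∷ as) = as

Dq : KPoly → KPoly
Dq f = PX.scale (divK 1K qMinus1NZ) (divX (argScale qK f PX.⊕ PX.neg f))

Op : Set
Op = KPoly → KPoly

opX : Op
opX f = PX.var PX.⊗ f

mulOp : KPoly → Op
mulOp g f = g PX.⊗ f

DqPow : ℕ → Op
DqPow zero f = f
DqPow (suc k) f = Dq (DqPow k f)

factorOp : ℕ → Op
factorOp i f = opX f PX.⊕ PX.scale (powK qK i *K sK) (Dq f)

lhsOp : ℕ → Op
lhsOp zero f = f
lhsOp (suc m) f = factorOp m (lhsOp m f)

gCoef : ℕ → ℕ → ℕ → K
gCoef n k j =
  powK sK j *K powK qK (j * j + k * j + k C 2) *K qbinK (n ∸ k) (2 * j)
  *K embed (oddFact j)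
  *K prodK k (λ i → divK (embed (onePlusQ (n ∸ j ∸ i))) (onePlusQNZ (j + 1 + i)))

gPoly : ℕ → ℕ → KPoly
gPoly n k = PX.scale (qbinK n k)
  (sumTo ⌊ (n ∸ k) /2⌋ (λ j → PX.scale (gCoef n k j) (PX.varPow (n ∸ k ∸ 2 * j))))

rhsOp : ℕ → Op
rhsOp n f = sumTo n (λ k → mulOp (gPoly n k) (PX.scale (powK sK k) (DqPow k f)))

hPoly : ℕ → KPoly
hPoly n = sumTo ⌊ n /2⌋ (λ j →
  PX.scale (powK qK (j * j) *K powK sK j
            *K (qfact n / (onePlusQNZs j ++ qfactNZs j ++ qfactNZs (n ∸ 2 * j))))
           (PX.varPow (n ∸ 2 * j)))

module Submission where

-- Proof by induction on n, comparing coefficients in x.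
--
-- For n = m + 2j + k the x^m-coefficient of g_n(k) is the closed product
--   coef m j k = s^j q^(j²+kj+C(k,2)) [n]! P(m+j+k) / ([k]! [m]! [j]! P(m+j) P(j+k)),
-- P(t) = (1+q)⋯(1+q^t), and it is 0 if n - k - m is odd or negative (ClosedForm).
-- A three-term identity of q-integers (QNumbers) gives, for n+1 = m + 2j + k,
--   coef m j k = coef (m-1) j k + q^n s [m+1] coef (m+1) (j-1) k + q^(n+m) coef m j (k-1)
-- (CoefficientRecurrence), i.e. g_{n+1}(k) = X g_n(k) + q^n s D_q g_n(k) + q^n g_n(k-1)(qX)
-- (GRecurrence).  With the q-Leibniz rule D_q(gh) = D_q g · h + g(qx) · D_q h
-- (QDerivative), the factor X + q^n s D_q turns Σ_k g_n(k) s^k D_q^k into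
-- Σ_k g_{n+1}(k) s^k D_q^k (OperatorIdentity).  For k = 0 the closed products are
-- the coefficients of h_n, which is the second part.

open import Defs
open import Data.Nat using (ℕ)
open import Data.Product using (_×_; _,_)
open import Algebra.Bundles using (CommutativeRing)
open import Level using (0ℓ)
open import Algebra.Structures using (IsCommutativeRing)

-- A commutative-ring structure moves along a logically equivalent equality.
-- (Both Polynomials and FractionField work with a record-wrapped equality and
-- transfer the result to the bare one used in Defs.)
isCommutativeRing-transfer :
  ∀ {A : Set} {_∼_ _≈_ : A → A → Set} {_+_ _*_ : A → A → A} { -_ : A → A} {0# 1# : A} →
  (∀ {x y} → x ∼ y → x ≈ y) → (∀ {x y} → x ≈ y → x ∼ y) →
  IsCommutativeRing _∼_ _+_ _*_ -_ 0# 1# → IsCommutativeRing _≈_ _+_ _*_ -_ 0# 1#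
isCommutativeRing-transfer to from S = record
  { isRing = record
    { +-isAbelianGroup = record
      { isGroup = record
        { isMonoid = record
          { isSemigroup = record
            { isMagma = record
              { isEquivalence = record
                { refl = to refl ; sym = λ h → to (sym (from h)) ; trans = λ h g → to (trans (from h) (from g)) }
              ; ∙-cong = λ h g → to (+-cong (from h) (from g)) }
            ; assoc = λ x y z → to (+-assoc x y z) }
          ; identity = (λ x → to (+-identityˡ x)) , (λ x → to (+-identityʳ x)) }
        ; inverse = (λ x → to (-‿inverseˡ x)) , (λ x → to (-‿inverseʳ x))
        ; ⁻¹-cong = λ h → to (-‿cong (from h)) }
      ; comm = λ x y → to (+-comm x y) }
    ; *-cong = λ h g → to (*-cong (from h) (from g))
    ; *-assoc = λ x y z → to (*-assoc x y z)
    ; *-identity = (λ x → to (*-identityˡ x)) , (λ x → to (*-identityʳ x))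
    ; distrib = (λ x y z → to (distribˡ x y z)) , (λ x y z → to (distribʳ x y z)) }
  ; *-comm = λ x y → to (*-comm x y) }
  where open IsCommutativeRing S

module Polynomials (R : CommutativeRing 0ℓ 0ℓ) where

  open import Data.List using ([]; _∷_)
  open import Data.Nat using (zero; suc)
  open import Data.Sum using (_⊎_; inj₁; inj₂; [_,_]′; map₁; map₂)
  open import Data.Empty using (⊥-elim)
  open import Relation.Nullary using (¬_)
  open import Relation.Binary.Bundles using (Setoid)
  open import Relation.Binary.Structures using (IsEquivalence)
  import Relation.Binary.Reasoning.Setoid as SetoidReasoning

  open CommutativeRing R hiding (_-_; zero)
  open import Algebra.Properties.Ring ring using (-0#≈0#)
  open import Algebra.Properties.CommutativeSemigroup +-commutativeSemigroup using (interchange)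
  open PolyOps 0# 1# _+_ _*_ -_ _≈_ public
  open SetoidReasoning setoid

  -- Coefficientwise equality p ≋ r unfolds to a Π-type, from which Agda cannot
  -- recover p and r; wrapping it in a record makes p and r inferable.
  infix 4 _≐_
  record _≐_ (p r : Poly) : Set where
    constructor mk
    field get : p ≋ r
  open _≐_ public

  ≐-refl : ∀ {p} → p ≐ p
  ≐-refl = mk (λ i → refl)

  ≐-sym : ∀ {p r} → p ≐ r → r ≐ p
  ≐-sym (mk h) = mk (λ i → sym (h i))

  ≐-trans : ∀ {p r t} → p ≐ r → r ≐ t → p ≐ t
  ≐-trans (mk h) (mk g) = mk (λ i → trans (h i) (g i))

  ≐-isEquivalence : IsEquivalence _≐_
  ≐-isEquivalence = record { refl = ≐-refl ; sym = ≐-sym ; trans = ≐-trans }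

  ≐-setoid : Setoid 0ℓ 0ℓ
  ≐-setoid = record { isEquivalence = ≐-isEquivalence }

  cons-cong : ∀ {a b p r} → a ≈ b → p ≐ r → (a ∷ p) ≐ (b ∷ r)
  cons-cong h (mk g) = mk λ { zero → h ; (suc i) → g i }

  cons-head : ∀ {a b p r} → (a ∷ p) ≐ (b ∷ r) → a ≈ b
  cons-head (mk h) = h 0

  cons-tail : ∀ {a b p r} → (a ∷ p) ≐ (b ∷ r) → p ≐ r
  cons-tail (mk h) = mk λ i → h (suc i)

  cons-zero : ∀ {a p} → a ≈ 0# → p ≐ [] → (a ∷ p) ≐ []
  cons-zero a0 (mk h) = mk λ { zero → a0 ; (suc i) → h i }

  cons-zero-head : ∀ {a p} → (a ∷ p) ≐ [] → a ≈ 0#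
  cons-zero-head (mk h) = h 0

  cons-zero-tail : ∀ {a p} → (a ∷ p) ≐ [] → p ≐ []
  cons-zero-tail (mk h) = mk λ i → h (suc i)

  coeff-⊕ : ∀ p r i → coeff (p ⊕ r) i ≈ coeff p i + coeff r i
  coeff-⊕ [] r i = sym (+-identityˡ _)
  coeff-⊕ (x ∷ xs) [] i = sym (+-identityʳ _)
  coeff-⊕ (x ∷ xs) (y ∷ ys) zero = refl
  coeff-⊕ (x ∷ xs) (y ∷ ys) (suc i) = coeff-⊕ xs ys i

  coeff-scale : ∀ c p i → coeff (scale c p) i ≈ c * coeff p i
  coeff-scale c [] i = sym (zeroʳ c)
  coeff-scale c (x ∷ p) zero = refl
  coeff-scale c (x ∷ p) (suc i) = coeff-scale c p i

  coeff-neg : ∀ p i → coeff (neg p) i ≈ - coeff p i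
  coeff-neg [] i = sym -0#≈0#
  coeff-neg (x ∷ p) zero = refl
  coeff-neg (x ∷ p) (suc i) = coeff-neg p i

  ⊕-cong : ∀ {p p' r r'} → p ≐ p' → r ≐ r' → (p ⊕ r) ≐ (p' ⊕ r')
  ⊕-cong {p} {p'} {r} {r'} (mk h) (mk g) =
    mk λ i → trans (coeff-⊕ p r i) (trans (+-cong (h i) (g i)) (sym (coeff-⊕ p' r' i)))

  ⊕-comm : ∀ p r → (p ⊕ r) ≐ (r ⊕ p)
  ⊕-comm p r = mk λ i → trans (coeff-⊕ p r i) (trans (+-comm _ _) (sym (coeff-⊕ r p i)))

  ⊕-assoc : ∀ p r t → ((p ⊕ r) ⊕ t) ≐ (p ⊕ (r ⊕ t))
  ⊕-assoc p r t = mk λ i → begin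
    coeff ((p ⊕ r) ⊕ t) i                ≈⟨ coeff-⊕ (p ⊕ r) t i ⟩
    coeff (p ⊕ r) i + coeff t i          ≈⟨ +-congʳ (coeff-⊕ p r i) ⟩
    (coeff p i + coeff r i) + coeff t i  ≈⟨ +-assoc _ _ _ ⟩
    coeff p i + (coeff r i + coeff t i)  ≈⟨ +-congˡ (sym (coeff-⊕ r t i)) ⟩
    coeff p i + coeff (r ⊕ t) i          ≈⟨ sym (coeff-⊕ p (r ⊕ t) i) ⟩
    coeff (p ⊕ (r ⊕ t)) i                ∎

  ⊕-identityˡ : ∀ p → ([] ⊕ p) ≐ p
  ⊕-identityˡ p = ≐-refl

  ⊕-identityʳ : ∀ p → (p ⊕ []) ≐ p
  ⊕-identityʳ p = ⊕-comm p []

  neg-cong : ∀ {p r} → p ≐ r → neg p ≐ neg r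
  neg-cong {p} {r} (mk h) = mk λ i → trans (coeff-neg p i) (trans (-‿cong (h i)) (sym (coeff-neg r i)))

  ⊕-inverseˡ : ∀ p → (neg p ⊕ p) ≐ []
  ⊕-inverseˡ p = mk λ i → trans (coeff-⊕ (neg p) p i) (trans (+-congʳ (coeff-neg p i)) (-‿inverseˡ _))

  ⊕-inverseʳ : ∀ p → (p ⊕ neg p) ≐ []
  ⊕-inverseʳ p = ≐-trans (⊕-comm p (neg p)) (⊕-inverseˡ p)

  ⊕-interchange : ∀ a b c d → ((a ⊕ b) ⊕ (c ⊕ d)) ≐ ((a ⊕ c) ⊕ (b ⊕ d))
  ⊕-interchange a b c d = mk λ i → begin
    coeff ((a ⊕ b) ⊕ (c ⊕ d)) i                        ≈⟨ coeff-⊕ (a ⊕ b) (c ⊕ d) i ⟩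
    coeff (a ⊕ b) i + coeff (c ⊕ d) i                  ≈⟨ +-cong (coeff-⊕ a b i) (coeff-⊕ c d i) ⟩
    (coeff a i + coeff b i) + (coeff c i + coeff d i)  ≈⟨ interchange _ _ _ _ ⟩
    (coeff a i + coeff c i) + (coeff b i + coeff d i)  ≈⟨ sym (+-cong (coeff-⊕ a c i) (coeff-⊕ b d i)) ⟩
    coeff (a ⊕ c) i + coeff (b ⊕ d) i                  ≈⟨ sym (coeff-⊕ (a ⊕ c) (b ⊕ d) i) ⟩
    coeff ((a ⊕ c) ⊕ (b ⊕ d)) i                        ∎

  ⊕-left-comm : ∀ a b c → (a ⊕ (b ⊕ c)) ≐ (b ⊕ (a ⊕ c))
  ⊕-left-comm a b c =
    ≐-trans (≐-sym (⊕-assoc a b c)) (≐-trans (⊕-cong (⊕-comm a b) ≐-refl) (⊕-assoc b a c))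

  scale-cong : ∀ {c d p r} → c ≈ d → p ≐ r → scale c p ≐ scale d r
  scale-cong {c} {d} {p} {r} h (mk g) =
    mk λ i → trans (coeff-scale c p i) (trans (*-cong h (g i)) (sym (coeff-scale d r i)))

  scale-⊕ : ∀ c p r → scale c (p ⊕ r) ≐ (scale c p ⊕ scale c r)
  scale-⊕ c p r = mk λ i → begin
    coeff (scale c (p ⊕ r)) i                      ≈⟨ coeff-scale c (p ⊕ r) i ⟩
    c * coeff (p ⊕ r) i                            ≈⟨ *-congˡ (coeff-⊕ p r i) ⟩
    c * (coeff p i + coeff r i)                    ≈⟨ distribˡ c _ _ ⟩
    c * coeff p i + c * coeff r i                  ≈⟨ sym (+-cong (coeff-scale c p i) (coeff-scale c r i)) ⟩
    coeff (scale c p) i + coeff (scale c r) i      ≈⟨ sym (coeff-⊕ (scale c p) (scale c r) i) ⟩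
    coeff (scale c p ⊕ scale c r) i                ∎

  scale-+ : ∀ c d p → scale (c + d) p ≐ (scale c p ⊕ scale d p)
  scale-+ c d p = mk λ i → begin
    coeff (scale (c + d) p) i                  ≈⟨ coeff-scale (c + d) p i ⟩
    (c + d) * coeff p i                        ≈⟨ distribʳ _ c d ⟩
    c * coeff p i + d * coeff p i              ≈⟨ sym (+-cong (coeff-scale c p i) (coeff-scale d p i)) ⟩
    coeff (scale c p) i + coeff (scale d p) i  ≈⟨ sym (coeff-⊕ (scale c p) (scale d p) i) ⟩
    coeff (scale c p ⊕ scale d p) i            ∎

  scale-scale : ∀ c d p → scale c (scale d p) ≐ scale (c * d) p
  scale-scale c d p = mk λ i → begin
    coeff (scale c (scale d p)) i  ≈⟨ coeff-scale c (scale d p) i ⟩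
    c * coeff (scale d p) i        ≈⟨ *-congˡ (coeff-scale d p i) ⟩
    c * (d * coeff p i)            ≈⟨ sym (*-assoc c d _) ⟩
    (c * d) * coeff p i            ≈⟨ sym (coeff-scale (c * d) p i) ⟩
    coeff (scale (c * d) p) i      ∎

  scale-1 : ∀ p → scale 1# p ≐ p
  scale-1 p = mk λ i → trans (coeff-scale 1# p i) (*-identityˡ _)

  scale-0 : ∀ p → scale 0# p ≐ []
  scale-0 p = mk λ i → trans (coeff-scale 0# p i) (zeroˡ _)

  shift-cong : ∀ {p r} → p ≐ r → shift p ≐ shift r
  shift-cong h = cons-cong refl h

  shift-⊕ : ∀ p r → shift (p ⊕ r) ≐ (shift p ⊕ shift r)
  shift-⊕ p r = cons-cong (sym (+-identityˡ 0#)) ≐-refl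

  shift-scale : ∀ c p → scale c (shift p) ≐ shift (scale c p)
  shift-scale c p = cons-cong (zeroʳ c) ≐-refl

  shift-[] : ∀ p → p ≐ [] → shift p ≐ []
  shift-[] p (mk h) = mk λ { zero → refl ; (suc i) → h i }

  shift-⊗ : ∀ p r → (shift p ⊗ r) ≐ shift (p ⊗ r)
  shift-⊗ p r = ⊕-cong (scale-0 r) ≐-refl

  ⊗-zeroˡ : ∀ p r → p ≐ [] → (p ⊗ r) ≐ []
  ⊗-zeroˡ [] r h = ≐-refl
  ⊗-zeroˡ (x ∷ p) r h =
    ⊕-cong (≐-trans (scale-cong (cons-zero-head h) ≐-refl) (scale-0 r))
           (shift-[] (p ⊗ r) (⊗-zeroˡ p r (cons-zero-tail h)))

  ⊗-zeroʳ : ∀ r → (r ⊗ []) ≐ []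
  ⊗-zeroʳ [] = ≐-refl
  ⊗-zeroʳ (x ∷ r) = shift-[] _ (⊗-zeroʳ r)

  ⊗-congˡ : ∀ {p p'} r → p ≐ p' → (p ⊗ r) ≐ (p' ⊗ r)
  ⊗-congˡ {[]} {p'} r h = ≐-sym (⊗-zeroˡ p' r (≐-sym h))
  ⊗-congˡ {x ∷ p} {[]} r h = ⊗-zeroˡ (x ∷ p) r h
  ⊗-congˡ {x ∷ p} {y ∷ p'} r h =
    ⊕-cong (scale-cong (cons-head h) ≐-refl) (shift-cong (⊗-congˡ r (cons-tail h)))

  ⊗-congʳ : ∀ p {r r'} → r ≐ r' → (p ⊗ r) ≐ (p ⊗ r')
  ⊗-congʳ [] h = ≐-refl
  ⊗-congʳ (x ∷ p) h = ⊕-cong (scale-cong refl h) (shift-cong (⊗-congʳ p h))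

  ⊗-cong : ∀ {p p' r r'} → p ≐ p' → r ≐ r' → (p ⊗ r) ≐ (p' ⊗ r')
  ⊗-cong {p} {p'} {r} {r'} h g = ≐-trans (⊗-congˡ r h) (⊗-congʳ p' g)

  ⊗-distribʳ : ∀ t p r → ((p ⊕ r) ⊗ t) ≐ ((p ⊗ t) ⊕ (r ⊗ t))
  ⊗-distribʳ t [] r = ≐-refl
  ⊗-distribʳ t (x ∷ p) [] = ≐-sym (⊕-identityʳ _)
  ⊗-distribʳ t (x ∷ p) (y ∷ r) = ≐-trans
    (⊕-cong (scale-+ x y t) (≐-trans (shift-cong (⊗-distribʳ t p r)) (shift-⊕ (p ⊗ t) (r ⊗ t))))
    (⊕-interchange (scale x t) (scale y t) (shift (p ⊗ t)) (shift (r ⊗ t)))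

  scale-⊗ : ∀ c p r → (scale c p ⊗ r) ≐ scale c (p ⊗ r)
  scale-⊗ c [] r = ≐-refl
  scale-⊗ c (x ∷ p) r = ≐-trans
    (⊕-cong (≐-sym (scale-scale c x r)) (≐-trans (shift-cong (scale-⊗ c p r)) (≐-sym (shift-scale c (p ⊗ r)))))
    (≐-sym (scale-⊕ c (scale x r) (shift (p ⊗ r))))

  ⊗-assoc : ∀ p r t → ((p ⊗ r) ⊗ t) ≐ (p ⊗ (r ⊗ t))
  ⊗-assoc [] r t = ≐-refl
  ⊗-assoc (x ∷ p) r t = ≐-trans (⊗-distribʳ t (scale x r) (shift (p ⊗ r)))
    (⊕-cong (scale-⊗ x r t) (≐-trans (shift-⊗ (p ⊗ r) t) (shift-cong (⊗-assoc p r t))))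

  ⊗-consʳ : ∀ p y ys → (p ⊗ (y ∷ ys)) ≐ (scale y p ⊕ shift (p ⊗ ys))
  ⊗-consʳ [] y ys = mk λ { zero → refl ; (suc i) → refl }
  ⊗-consʳ (x ∷ xs) y ys = cons-cong (+-cong (*-comm x y) refl)
    (≐-trans (⊕-cong ≐-refl (⊗-consʳ xs y ys)) (⊕-left-comm (scale x ys) (scale y xs) (shift (xs ⊗ ys))))

  ⊗-comm : ∀ p r → (p ⊗ r) ≐ (r ⊗ p)
  ⊗-comm [] r = ≐-sym (⊗-zeroʳ r)
  ⊗-comm (x ∷ p) r = ≐-trans (⊕-cong ≐-refl (shift-cong (⊗-comm p r))) (≐-sym (⊗-consʳ r x p))

  ⊗-identityˡ : ∀ p → (oneP ⊗ p) ≐ p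
  ⊗-identityˡ p = ≐-trans (⊕-cong (scale-1 p) (shift-[] [] ≐-refl)) (⊕-identityʳ p)

  ⊗-identityʳ : ∀ p → (p ⊗ oneP) ≐ p
  ⊗-identityʳ p = ≐-trans (⊗-comm p oneP) (⊗-identityˡ p)

  ⊗-distribˡ : ∀ t p r → (t ⊗ (p ⊕ r)) ≐ ((t ⊗ p) ⊕ (t ⊗ r))
  ⊗-distribˡ t p r =
    ≐-trans (⊗-comm t _) (≐-trans (⊗-distribʳ t p r) (⊕-cong (⊗-comm p t) (⊗-comm r t)))

  poly-isCommutativeRing : IsCommutativeRing _≐_ _⊕_ _⊗_ neg [] oneP
  poly-isCommutativeRing = record
    { isRing = record
      { +-isAbelianGroup = record
        { isGroup = record
          { isMonoid = record
            { isSemigroup = record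
              { isMagma = record { isEquivalence = ≐-isEquivalence ; ∙-cong = ⊕-cong }
              ; assoc = ⊕-assoc }
            ; identity = ⊕-identityˡ , ⊕-identityʳ }
          ; inverse = ⊕-inverseˡ , ⊕-inverseʳ
          ; ⁻¹-cong = neg-cong }
        ; comm = ⊕-comm }
      ; *-cong = ⊗-cong
      ; *-assoc = ⊗-assoc
      ; *-identity = ⊗-identityˡ , ⊗-identityʳ
      ; distrib = ⊗-distribˡ , ⊗-distribʳ }
    ; *-comm = ⊗-comm }

  polyRing : CommutativeRing 0ℓ 0ℓ
  polyRing = record { isCommutativeRing = poly-isCommutativeRing }

  open import Algebra.Properties.Ring (CommutativeRing.ring polyRing) public
    using () renaming (-‿distribˡ-* to neg-⊗ˡ)

  -- R[x] with the bare equality _≋_, in the form Defs iterates the construction.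
  polyRing≋ : CommutativeRing 0ℓ 0ℓ
  polyRing≋ = record { isCommutativeRing = isCommutativeRing-transfer get mk poly-isCommutativeRing }

  const-⊗ : ∀ a b → constP (a * b) ≐ (constP a ⊗ constP b)
  const-⊗ a b = cons-cong (sym (+-identityʳ (a * b))) ≐-refl

  const-cong : ∀ {a b} → a ≈ b → constP a ≐ constP b
  const-cong h = cons-cong h ≐-refl

  const-0 : constP 0# ≐ []
  const-0 = mk λ { zero → refl ; (suc i) → refl }

  var-⊗ : ∀ p → (var ⊗ p) ≐ shift p
  var-⊗ p = ⊕-cong (scale-0 p) (shift-cong (⊗-identityˡ p))

  -- Over an integral domain R, R[x] is again an integral domain: compare
  -- lowest coefficients, and strip a zero lowest coefficient off a factor.
  module Domain (integral : ∀ a b → (a * b) ≈ 0# → (a ≈ 0#) ⊎ (b ≈ 0#)) where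

    noZeroDivisors : ∀ p r → (p ⊗ r) ≐ [] → (p ≐ []) ⊎ (r ≐ [])
    noZeroDivisors [] r h = inj₁ ≐-refl
    noZeroDivisors (a ∷ p) [] h = inj₂ ≐-refl
    noZeroDivisors (a ∷ p) (b ∷ r) h =
      [ (λ a0 → map₁ (cons-zero a0) (noZeroDivisors p (b ∷ r) (cons-zero-tail (dropˡ a0))))
      , (λ b0 → map₂ (cons-zero b0) (noZeroDivisors (a ∷ p) r (cons-zero-tail (dropʳ b0)))) ]′
      (integral a b (trans (sym (+-identityʳ (a * b))) (cons-zero-head h)))
      where
      -- if a = 0 then (a ∷ p)(b ∷ r) = x · p(b ∷ r)
      dropˡ : a ≈ 0# → shift (p ⊗ (b ∷ r)) ≐ []
      dropˡ a0 = ≐-trans (≐-sym (shift-⊗ p (b ∷ r))) (≐-trans (⊗-congˡ (b ∷ r) (cons-cong (sym a0) (≐-refl {p}))) h)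
      -- if b = 0 then (a ∷ p)(b ∷ r) = x · (a ∷ p) r
      dropʳ : b ≈ 0# → shift ((a ∷ p) ⊗ r) ≐ []
      dropʳ b0 = ≐-trans (shift-cong (⊗-comm (a ∷ p) r))
                (≐-trans (≐-sym (shift-⊗ r (a ∷ p)))
                (≐-trans (⊗-comm (0# ∷ r) (a ∷ p))
                (≐-trans (⊗-congʳ (a ∷ p) (cons-cong (sym b0) (≐-refl {r}))) h)))

    ⊗-nonzero : ∀ p r → ¬ (p ≐ []) → ¬ (r ≐ []) → ¬ ((p ⊗ r) ≐ [])
    ⊗-nonzero p r np nr h = [ np , nr ]′ (noZeroDivisors p r h)

    -- Cancellation of a nonzero factor: (p - r) d = 0 forces p - r = 0.
    ⊗-cancelʳ : ∀ p r d → (p ⊗ d) ≐ (r ⊗ d) → ¬ (d ≐ []) → p ≐ r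
    ⊗-cancelʳ p r d h nz = [ difference-zero , (λ d0 → ⊥-elim (nz d0)) ]′ (noZeroDivisors (p ⊕ neg r) d product-zero)
      where
      product-zero : ((p ⊕ neg r) ⊗ d) ≐ []
      product-zero = ≐-trans (⊗-distribʳ d p (neg r))
        (≐-trans (⊕-cong h (≐-sym (neg-⊗ˡ r d))) (⊕-inverseʳ (r ⊗ d)))
      difference-zero : (p ⊕ neg r) ≐ [] → p ≐ r
      difference-zero e0 = ≐-trans (≐-sym (⊕-identityʳ p))
        (≐-trans (⊕-cong (≐-refl {p}) (≐-sym (⊕-inverseˡ r)))
        (≐-trans (≐-sym (⊕-assoc p (neg r) r)) (⊕-cong e0 (≐-refl {r}))))

-- The field K = ℚ(q,s) of Defs: a fraction a / [d₁,…,dᵣ] stands for a / (d₁⋯dᵣ)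
-- with a, dᵢ ∈ ℤ[q,s], dᵢ ≠ 0.  The ring laws reduce to polynomial identities
-- in ℤ[q,s]; transitivity of ≈ cancels a nonzero denominator, which is where
-- ℤ[q,s] being an integral domain is used.
module FractionField where

  open import Data.Integer.Properties using (+-*-commutativeRing; i*j≡0⇒i≡0∨j≡0)
  open import Data.List using ([]; _∷_; _++_)
  open import Data.Sum using (map)
  open import Data.Maybe using (nothing)
  open import Relation.Nullary using (¬_)
  open import Tactic.RingSolver.Core.AlmostCommutativeRing using (fromCommutativeRing)
  import Tactic.RingSolver.NonReflective as NonReflective
  import Relation.Binary.Reasoning.Setoid as SetoidReasoning

  module Zs = Polynomials +-*-commutativeRing
  module ZsDomain = Zs.Domain (λ a b h → i*j≡0⇒i≡0∨j≡0 a h)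
  module Zqs = Polynomials Zs.polyRing≋
  module ZqsDomain = Zqs.Domain (λ a b h → map Zs.get Zs.get (ZsDomain.noZeroDivisors a b (Zs.mk h)))

  open Zqs using (_≐_; mk; get; ≐-refl; ≐-sym; ≐-trans) renaming (_⊕_ to _+P_; _⊗_ to _*P_; neg to -P_)
  module ZqsSolver = NonReflective (fromCommutativeRing Zqs.polyRing (λ _ → nothing))
  open ZqsSolver using (solve; _⊜_) renaming (_⊕_ to _:+_; _⊗_ to _:*_; ⊝_ to :-_)
  private
    module ZqsReasoning = SetoidReasoning Zqs.≐-setoid

  den : K → Poly2
  den x = denProd (dens x)

  den-nonzero : ∀ ds → ¬ (denProd ds ≐ [])
  den-nonzero [] (mk h) with h 0 0
  ... | ()
  den-nonzero ((d , nz) ∷ ds) = ZqsDomain.⊗-nonzero d (denProd ds) (λ h → nz (get h)) (den-nonzero ds)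

  den-++ : ∀ ds es → denProd (ds ++ es) ≐ (denProd ds *P denProd es)
  den-++ [] es = ≐-sym (Zqs.⊗-identityˡ _)
  den-++ ((d , _) ∷ ds) es = ≐-trans (Zqs.⊗-congʳ d (den-++ ds es)) (≐-sym (Zqs.⊗-assoc d _ _))

  den-+ : ∀ x y → den (x +K y) ≐ (den x *P den y)
  den-+ x y = den-++ (dens x) (dens y)

  den-* : ∀ x y → den (x *K y) ≐ (den x *P den y)
  den-* x y = den-++ (dens x) (dens y)

  -- Equality of fractions (cross multiplication), wrapped in a record so that
  -- the two fractions are inferable; ≈K of Defs is its bare version.
  infix 4 _≈k_
  record _≈k_ (x y : K) : Set where
    constructor mkK
    field getK : (num x *P den y) ≐ (num y *P den x)
  open _≈k_ public

  ≈k-refl : ∀ {x} → x ≈k x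
  ≈k-refl = mkK ≐-refl

  ≈k-sym : ∀ {x y} → x ≈k y → y ≈k x
  ≈k-sym (mkK h) = mkK (≐-sym h)

  -- a/da = b/db = c/dc gives (a dc) db = (c da) db; cancel db ≠ 0
  ≈k-trans : ∀ {x y z} → x ≈k y → y ≈k z → x ≈k z
  ≈k-trans {a / xs} {b / ys} {c / zs} (mkK h) (mkK g) =
    mkK (ZqsDomain.⊗-cancelʳ (a *P dz) (c *P dx) dy cross (den-nonzero ys))
    where
    dx = denProd xs
    dy = denProd ys
    dz = denProd zs
    open ZqsReasoning
    cross : ((a *P dz) *P dy) ≐ ((c *P dx) *P dy)
    cross = begin
      (a *P dz) *P dy ≈⟨ solve 3 (λ a dz dy → (a :* dz) :* dy ⊜ ((a :* dy) :* dz)) ≐-refl a dz dy ⟩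
      (a *P dy) *P dz ≈⟨ Zqs.⊗-congˡ dz h ⟩
      (b *P dx) *P dz ≈⟨ solve 3 (λ b dx dz → (b :* dx) :* dz ⊜ ((b :* dz) :* dx)) ≐-refl b dx dz ⟩
      (b *P dz) *P dx ≈⟨ Zqs.⊗-congˡ dx g ⟩
      (c *P dy) *P dx ≈⟨ solve 3 (λ c dy dx → (c :* dy) :* dx ⊜ ((c :* dx) :* dy)) ≐-refl c dy dx ⟩
      (c *P dx) *P dy ∎

  ≈k-via : ∀ x y {nx dx ny dy} → num x ≐ nx → den x ≐ dx → num y ≐ ny → den y ≐ dy →
           (nx *P dy) ≐ (ny *P dx) → x ≈k y
  ≈k-via x y h1 h2 h3 h4 e = mkK (≐-trans (Zqs.⊗-cong h1 h4) (≐-trans e (≐-sym (Zqs.⊗-cong h3 h2))))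

  +K-cong : ∀ {x x' y y'} → x ≈k x' → y ≈k y' → (x +K y) ≈k (x' +K y')
  +K-cong {x} {x'} {y} {y'} (mkK h) (mkK g) =
    ≈k-via (x +K y) (x' +K y') ≐-refl (den-+ x y) ≐-refl (den-+ x' y') cross
    where
    a = num x ; b = den x ; a' = num x' ; b' = den x'
    c = num y ; d = den y ; c' = num y' ; d' = den y'
    open ZqsReasoning
    cross : (((a *P d) +P (c *P b)) *P (b' *P d')) ≐ (((a' *P d') +P (c' *P b')) *P (b *P d))
    cross = begin
      ((a *P d) +P (c *P b)) *P (b' *P d')
        ≈⟨ solve 6 (λ a b c d b' d' → ((a :* d) :+ (c :* b)) :* (b' :* d')
                                     ⊜ ((a :* b') :* (d :* d') :+ (c :* d') :* (b :* b'))) ≐-refl a b c d b' d' ⟩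
      ((a *P b') *P (d *P d')) +P ((c *P d') *P (b *P b'))
        ≈⟨ Zqs.⊕-cong (Zqs.⊗-congˡ _ h) (Zqs.⊗-congˡ _ g) ⟩
      ((a' *P b) *P (d *P d')) +P ((c' *P d) *P (b *P b'))
        ≈⟨ solve 6 (λ a' b c' d b' d' → (a' :* b) :* (d :* d') :+ (c' :* d) :* (b :* b')
                                       ⊜ (((a' :* d') :+ (c' :* b')) :* (b :* d))) ≐-refl a' b c' d b' d' ⟩
      ((a' *P d') +P (c' *P b')) *P (b *P d) ∎

  *K-cong : ∀ {x x' y y'} → x ≈k x' → y ≈k y' → (x *K y) ≈k (x' *K y')
  *K-cong {x} {x'} {y} {y'} (mkK h) (mkK g) =
    ≈k-via (x *K y) (x' *K y') ≐-refl (den-* x y) ≐-refl (den-* x' y') cross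
    where
    a = num x ; b = den x ; a' = num x' ; b' = den x'
    c = num y ; d = den y ; c' = num y' ; d' = den y'
    open ZqsReasoning
    cross : ((a *P c) *P (b' *P d')) ≐ ((a' *P c') *P (b *P d))
    cross = begin
      (a *P c) *P (b' *P d') ≈⟨ solve 4 (λ a c b' d' → (a :* c) :* (b' :* d') ⊜ ((a :* b') :* (c :* d'))) ≐-refl a c b' d' ⟩
      (a *P b') *P (c *P d') ≈⟨ Zqs.⊗-cong h g ⟩
      (a' *P b) *P (c' *P d) ≈⟨ solve 4 (λ a' b c' d → (a' :* b) :* (c' :* d) ⊜ ((a' :* c') :* (b :* d))) ≐-refl a' b c' d ⟩
      (a' *P c') *P (b *P d) ∎

  -K-cong : ∀ {x x'} → x ≈k x' → (-K x) ≈k (-K x')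
  -K-cong {x} {x'} (mkK h) = mkK (begin
      (-P num x) *P den x'  ≈⟨ solve 2 (λ a b' → (:- a) :* b' ⊜ (:- (a :* b'))) ≐-refl (num x) (den x') ⟩
      -P (num x *P den x')  ≈⟨ Zqs.neg-cong h ⟩
      -P (num x' *P den x)  ≈⟨ solve 2 (λ a' b → :- (a' :* b) ⊜ ((:- a') :* b)) ≐-refl (num x') (den x) ⟩
      (-P num x') *P den x  ∎)
    where open ZqsReasoning

  +K-assoc : ∀ x y z → ((x +K y) +K z) ≈k (x +K (y +K z))
  +K-assoc x y z = ≈k-via ((x +K y) +K z) (x +K (y +K z))
    (Zqs.⊕-cong ≐-refl (Zqs.⊗-congʳ (num z) (den-+ x y)))
    (≐-trans (den-++ (dens x ++ dens y) (dens z)) (Zqs.⊗-congˡ (den z) (den-+ x y)))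
    (Zqs.⊕-cong (Zqs.⊗-congʳ (num x) (den-+ y z)) ≐-refl)
    (≐-trans (den-++ (dens x) (dens y ++ dens z)) (Zqs.⊗-congʳ (den x) (den-+ y z)))
    (solve 6 (λ a b c d e f → ((a :* d :+ c :* b) :* f :+ e :* (b :* d)) :* (b :* (d :* f))
                            ⊜ ((a :* (d :* f) :+ (c :* f :+ e :* d) :* b) :* ((b :* d) :* f))) ≐-refl
      (num x) (den x) (num y) (den y) (num z) (den z))

  +K-comm : ∀ x y → (x +K y) ≈k (y +K x)
  +K-comm x y = ≈k-via (x +K y) (y +K x) ≐-refl (den-+ x y) ≐-refl (den-+ y x)
    (solve 4 (λ a b c d → (a :* d :+ c :* b) :* (d :* b) ⊜ ((c :* b :+ a :* d) :* (b :* d))) ≐-refl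
      (num x) (den x) (num y) (den y))

  +K-identityˡ : ∀ x → (0K +K x) ≈k x
  +K-identityˡ x = ≈k-via (0K +K x) x ≐-refl (den-++ [] (dens x)) ≐-refl ≐-refl
    (solve 3 (λ a b u → (a :* u) :* b ⊜ (a :* (u :* b))) ≐-refl (num x) (den x) P2.oneP)

  -K-inverseˡ : ∀ x → ((-K x) +K x) ≈k 0K
  -K-inverseˡ x = ≈k-via ((-K x) +K x) 0K ≐-refl (den-+ (-K x) x) ≐-refl ≐-refl
    (Zqs.⊗-zeroˡ _ P2.oneP (≐-trans (Zqs.⊕-cong (≐-sym (Zqs.neg-⊗ˡ (num x) (den x))) ≐-refl)
                                     (Zqs.⊕-inverseˡ (num x *P den x))))

  *K-assoc : ∀ x y z → ((x *K y) *K z) ≈k (x *K (y *K z))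
  *K-assoc x y z = ≈k-via ((x *K y) *K z) (x *K (y *K z)) ≐-refl
    (≐-trans (den-++ (dens x ++ dens y) (dens z)) (Zqs.⊗-congˡ (den z) (den-* x y))) ≐-refl
    (≐-trans (den-++ (dens x) (dens y ++ dens z)) (Zqs.⊗-congʳ (den x) (den-* y z)))
    (solve 6 (λ a b c d e f → ((a :* c) :* e) :* (b :* (d :* f)) ⊜ ((a :* (c :* e)) :* ((b :* d) :* f))) ≐-refl
      (num x) (den x) (num y) (den y) (num z) (den z))

  *K-comm : ∀ x y → (x *K y) ≈k (y *K x)
  *K-comm x y = ≈k-via (x *K y) (y *K x) ≐-refl (den-* x y) ≐-refl (den-* y x)
    (solve 4 (λ a b c d → (a :* c) :* (d :* b) ⊜ ((c :* a) :* (b :* d))) ≐-refl (num x) (den x) (num y) (den y))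

  *K-identityˡ : ∀ x → (1K *K x) ≈k x
  *K-identityˡ x = ≈k-via (1K *K x) x ≐-refl (den-++ [] (dens x)) ≐-refl ≐-refl
    (solve 3 (λ a b u → (u :* a) :* b ⊜ (a :* (u :* b))) ≐-refl (num x) (den x) P2.oneP)

  *K-distribʳ : ∀ x y z → ((y +K z) *K x) ≈k ((y *K x) +K (z *K x))
  *K-distribʳ x y z = ≈k-via ((y +K z) *K x) ((y *K x) +K (z *K x)) ≐-refl
    (≐-trans (den-++ (dens y ++ dens z) (dens x)) (Zqs.⊗-congˡ (den x) (den-+ y z)))
    (Zqs.⊕-cong (Zqs.⊗-congʳ (num y *P num x) (den-* z x)) (Zqs.⊗-congʳ (num z *P num x) (den-* y x)))
    (≐-trans (den-++ (dens y ++ dens x) (dens z ++ dens x)) (Zqs.⊗-cong (den-* y x) (den-* z x)))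
    (solve 6 (λ a b c d e f → ((c :* f :+ e :* d) :* a) :* ((d :* b) :* (f :* b))
                            ⊜ (((c :* a) :* (f :* b) :+ (e :* a) :* (d :* b)) :* ((d :* f) :* b))) ≐-refl
      (num x) (den x) (num y) (den y) (num z) (den z))

  K-isCommutativeRing : IsCommutativeRing _≈k_ _+K_ _*K_ -K_ 0K 1K
  K-isCommutativeRing = record
    { isRing = record
      { +-isAbelianGroup = record
        { isGroup = record
          { isMonoid = record
            { isSemigroup = record
              { isMagma = record
                { isEquivalence = record { refl = ≈k-refl ; sym = ≈k-sym ; trans = ≈k-trans }
                ; ∙-cong = +K-cong }
              ; assoc = +K-assoc }
            ; identity = +K-identityˡ , (λ x → ≈k-trans (+K-comm x 0K) (+K-identityˡ x)) }
          ; inverse = -K-inverseˡ , (λ x → ≈k-trans (+K-comm x (-K x)) (-K-inverseˡ x))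
          ; ⁻¹-cong = -K-cong }
        ; comm = +K-comm }
      ; *-cong = *K-cong
      ; *-assoc = *K-assoc
      ; *-identity = *K-identityˡ , (λ x → ≈k-trans (*K-comm x 1K) (*K-identityˡ x))
      ; distrib = (λ x y z → ≈k-trans (*K-comm x (y +K z))
                              (≈k-trans (*K-distribʳ x y z) (+K-cong (*K-comm y x) (*K-comm z x))))
                , *K-distribʳ }
    ; *-comm = *K-comm }

  K-ring : CommutativeRing 0ℓ 0ℓ
  K-ring = record { isCommutativeRing = K-isCommutativeRing }

  K-ring≈ : CommutativeRing 0ℓ 0ℓ
  K-ring≈ = record { isCommutativeRing = isCommutativeRing-transfer (λ h → get (getK h)) (λ h → mkK (mk h)) K-isCommutativeRing }

  module KX = Polynomials K-ring≈

module KAlgebra where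

  open FractionField public
  open import Data.Nat using (ℕ; zero; suc)
  open import Data.Integer using (ℤ)
  import Data.Integer as ℤ
  open import Data.Integer.Properties using (+-*-commutativeRing)
  open import Data.List using (List; []; _∷_; _++_)
  open import Data.Product using (proj₁)
  open import Data.Maybe using (Maybe; nothing; just)
  open import Relation.Binary.PropositionalEquality using (_≡_; refl)
  open import Relation.Nullary using (yes; no)
  open Zqs using (_≐_; ≐-refl; ≐-sym; ≐-trans) renaming (_⊕_ to _+P_)
  import Algebra.Solver.Ring.AlmostCommutativeRing as ACR
  import Algebra.Solver.Ring as RingSolver
  import Relation.Binary.Reasoning.Setoid as SetoidReasoning

  module KR = CommutativeRing K-ring
  module KReason = SetoidReasoning KR.setoid
  open KReason

  infixl 7 _*≈_ _≈*_
  infixl 6 _+≈_ _≈+_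
  _*≈_ : ∀ x {y z} → y ≈k z → (x *K y) ≈k (x *K z)
  x *≈ h = KR.*-cong (≈k-refl {x}) h
  _≈*_ : ∀ {y z} → y ≈k z → ∀ x → (y *K x) ≈k (z *K x)
  h ≈* x = KR.*-cong h (≈k-refl {x})
  _+≈_ : ∀ x {y z} → y ≈k z → (x +K y) ≈k (x +K z)
  x +≈ h = KR.+-cong (≈k-refl {x}) h
  _≈+_ : ∀ {y z} → y ≈k z → ∀ x → (y +K x) ≈k (z +K x)
  h ≈+ x = KR.+-cong h (≈k-refl {x})

  ≡→≈ : ∀ {x y} → x ≡ y → x ≈k y
  ≡→≈ refl = ≈k-refl

  ≈refl : ∀ x → x ≈k x
  ≈refl x = ≈k-refl {x}

  *-cong₉ : ∀ {a b c d e f g h i a' b' c' d' e' f' g' h' i'} →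
    a ≈k a' → b ≈k b' → c ≈k c' → d ≈k d' → e ≈k e' → f ≈k f' → g ≈k g' → h ≈k h' → i ≈k i' →
    (a *K b *K c *K d *K e *K f *K g *K h *K i) ≈k (a' *K b' *K c' *K d' *K e' *K f' *K g' *K h' *K i')
  *-cong₉ a b c d e f g h i =
    KR.*-cong (KR.*-cong (KR.*-cong (KR.*-cong (KR.*-cong (KR.*-cong (KR.*-cong (KR.*-cong a b) c) d) e) f) g) h) i

  embed-cong : ∀ {p r} → p ≐ r → embed p ≈k embed r
  embed-cong h = mkK (Zqs.⊗-cong h ≐-refl)

  embed-+ : ∀ p r → embed (p +P r) ≈k (embed p +K embed r)
  embed-+ p r = mkK (Zqs.⊗-congˡ P2.oneP (Zqs.⊕-cong (≐-sym (Zqs.⊗-identityʳ p)) (≐-sym (Zqs.⊗-identityʳ r))))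

  embed-shift : ∀ p → embed (P2.shift p) ≈k (qK *K embed p)
  embed-shift p = embed-cong (≐-sym (Zqs.var-⊗ p))

  -- ℤ ⊆ K is a ring homomorphism; with it, Algebra.Solver.Ring decides
  -- identities of K with integer constants.
  intK : ℤ → K
  intK i = embed (P2.constP (P1.constP i))

  intK-hom : ACR._-Raw-AlmostCommutative⟶_ (CommutativeRing.rawRing +-*-commutativeRing) (ACR.fromCommutativeRing K-ring)
  intK-hom = record
    { ⟦_⟧ = intK
    ; +-homo = λ a b → embed-+ (P2.constP (P1.constP a)) (P2.constP (P1.constP b))
    ; *-homo = λ a b → embed-cong (≐-trans (Zqs.const-cong (Zs.get (Zs.const-⊗ a b))) (Zqs.const-⊗ (P1.constP a) (P1.constP b)))
    ; -‿homo = λ a → ≈k-refl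
    ; 0-homo = embed-cong (≐-trans (Zqs.const-cong (Zs.get Zs.const-0)) Zqs.const-0)
    ; 1-homo = ≈k-refl }

  intK-test : ∀ a b → Maybe (intK a ≈k intK b)
  intK-test a b with a ℤ.≟ b
  ... | yes refl = just ≈k-refl
  ... | no _ = nothing

  module SK = RingSolver (CommutativeRing.rawRing +-*-commutativeRing) (ACR.fromCommutativeRing K-ring) intK-hom intK-test

  one : ∀ {n} → SK.Polynomial n
  one = SK.con (ℤ.+ 1)

  *-interchange : ∀ a b c d → ((a *K b) *K (c *K d)) ≈k ((a *K c) *K (b *K d))
  *-interchange = SK.solve 4 (λ a b c d → (a SK.:* b) SK.:* (c SK.:* d) SK.:= (a SK.:* c) SK.:* (b SK.:* d)) ≈k-refl

  drop-unit : ∀ {X Z u} → X ≈k (Z *K u) → u ≈k 1K → X ≈k Z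
  drop-unit {X} {Z} {u} h hu = KR.trans h (KR.trans (Z *≈ hu) (KR.*-identityʳ Z))

  drop-units : ∀ {X Z u v} → X ≈k (Z *K (u *K v)) → u ≈k 1K → v ≈k 1K → X ≈k Z
  drop-units {X} {Z} {u} {v} h hu hv = drop-unit h (KR.trans (KR.*-cong hu hv) (KR.*-identityʳ 1K))

  cancel-unit : ∀ {X Y} d i → (i *K d) ≈k 1K → (X *K d) ≈k (Y *K d) → X ≈k Y
  cancel-unit {X} {Y} d i h e = begin
    X              ≈⟨ KR.sym (drop-unit ≈k-refl h) ⟩
    X *K (i *K d)  ≈⟨ SK.solve 3 (λ x i d → x SK.:* (i SK.:* d) SK.:= (x SK.:* d) SK.:* i) ≈k-refl X i d ⟩
    (X *K d) *K i  ≈⟨ e ≈* i ⟩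
    (Y *K d) *K i  ≈⟨ SK.solve 3 (λ x i d → (x SK.:* d) SK.:* i SK.:= x SK.:* (i SK.:* d)) ≈k-refl Y i d ⟩
    Y *K (i *K d)  ≈⟨ drop-unit ≈k-refl h ⟩
    Y              ∎

  inv : NZ → K
  inv d = P2.oneP / (d ∷ [])

  inv-l : ∀ d → (inv d *K embed (proj₁ d)) ≈k 1K
  inv-l (d , _) = mkK (ZqsSolver.solve 2 (λ u d → (u ZqsSolver.⊗ d) ZqsSolver.⊗ u ZqsSolver.⊜ (u ZqsSolver.⊗ (d ZqsSolver.⊗ u))) ≐-refl P2.oneP d)

  invList : List NZ → K
  invList ds = P2.oneP / ds

  invList-++ : ∀ ds es → invList (ds ++ es) ≈k (invList ds *K invList es)
  invList-++ ds es = mkK (Zqs.⊗-congˡ (denProd (ds ++ es)) (≐-sym (Zqs.⊗-identityʳ P2.oneP)))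

  frac-split : ∀ a ds → (a / ds) ≈k (embed a *K invList ds)
  frac-split a ds = mkK (Zqs.⊗-congˡ (denProd ds) (≐-sym (Zqs.⊗-identityʳ a)))

  prodK-cong : ∀ k {f g : ℕ → K} → (∀ i → f i ≈k g i) → prodK k f ≈k prodK k g
  prodK-cong zero h = ≈k-refl
  prodK-cong (suc k) h = KR.*-cong (prodK-cong k h) (h k)

  prodK-mul : ∀ k (f g : ℕ → K) → prodK k (λ i → f i *K g i) ≈k (prodK k f *K prodK k g)
  prodK-mul zero f g = KR.sym (KR.*-identityʳ 1K)
  prodK-mul (suc k) f g = KR.trans (prodK-mul k f g ≈* (f k *K g k)) (*-interchange (prodK k f) (prodK k g) (f k) (g k))

-- The coefficient of x^m in g_n(k) is indexed by the j with
-- n = m + 2j + k; call (m, j, k) a shape of n.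
module IndexArithmetic where

  open import Data.Nat using (ℕ; zero; suc; _+_; _*_; _∸_; _≤_; z≤n; s≤s; ⌊_/2⌋; _≤?_)
  open import Data.Nat.Combinatorics using (_C_; nC1≡n; nCk+nC[k+1]≡[n+1]C[k+1])
  open import Data.Nat.Tactic.RingSolver using (solve-∀)
  import Data.Nat.Properties as NP
  open import Data.Product using (Σ; _,_)
  open import Data.Sum using (_⊎_; inj₁; inj₂)
  open import Data.Empty using (⊥)
  open import Relation.Binary.PropositionalEquality using (_≡_; _≢_; refl; cong; sym; trans; subst)
  open import Relation.Nullary using (yes; no)

  qExp : ℕ → ℕ → ℕ
  qExp j k = j * j + k * j + k C 2

  qExp-k0 : ∀ j → qExp j 0 ≡ j * j
  qExp-k0 j = trans (NP.+-identityʳ (j * j + 0)) (NP.+-identityʳ (j * j))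

  qExp-suc-j : ∀ j k → qExp (suc j) k ≡ qExp j k + suc (2 * j + k)
  qExp-suc-j j k = expand j k (k C 2)
    where
    expand : ∀ j k c → suc j * suc j + k * suc j + c ≡ (j * j + k * j + c) + suc (2 * j + k)
    expand = solve-∀

  -- C(k+1,2) = k + C(k,2), by Pascal's rule
  suc-C2 : ∀ k → suc k C 2 ≡ k + k C 2
  suc-C2 k = trans (sym (nCk+nC[k+1]≡[n+1]C[k+1] k 1)) (cong (_+ k C 2) (nC1≡n k))

  qExp-suc-k : ∀ j k → qExp j (suc k) ≡ qExp j k + (j + k)
  qExp-suc-k j k = trans (cong (λ c → j * j + suc k * j + c) (suc-C2 k)) (expand j k (k C 2))
    where
    expand : ∀ j k c → j * j + suc k * j + (k + c) ≡ (j * j + k * j + c) + (j + k)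
    expand = solve-∀

  N-suc-j : ∀ m j k → m + 2 * suc j + k ≡ suc (suc (m + 2 * j + k))
  N-suc-j = solve-∀

  M-suc-j : ∀ m j k → m + suc j + k ≡ suc (m + j + k)
  M-suc-j = solve-∀

  N-suc-k : ∀ m j k → m + 2 * j + suc k ≡ suc (m + 2 * j + k)
  N-suc-k = solve-∀

  M-suc-k : ∀ m j k → m + j + suc k ≡ suc (m + j + k)
  M-suc-k = solve-∀

  double-suc : ∀ j → 2 * suc j ≡ suc (suc (2 * j))
  double-suc = solve-∀

  double-suc′ : ∀ j → suc (suc (2 * j)) ≡ suc j + suc j
  double-suc′ = solve-∀

  j+1+i : ∀ j i → j + 1 + i ≡ suc (j + i)
  j+1+i = solve-∀

  n-suc-j : ∀ n m j k → suc n ≡ m + 2 * suc j + k → n ≡ m + suc (2 * j + k)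
  n-suc-j n m j k h = NP.suc-injective (trans h (regroup m j k))
    where
    regroup : ∀ m j k → m + 2 * suc j + k ≡ suc (m + suc (2 * j + k))
    regroup = solve-∀

  n+m-suc-k : ∀ n m j k → suc n ≡ m + 2 * j + suc k → n + m ≡ (j + k) + (m + m + j)
  n+m-suc-k n m j k h = trans (cong (_+ m) (NP.suc-injective (trans h (N-suc-k m j k)))) (regroup m j k)
    where
    regroup : ∀ m j k → m + 2 * j + k + m ≡ (j + k) + (m + m + j)
    regroup = solve-∀

  N∸k : ∀ m j k → m + 2 * j + k ∸ k ≡ m + 2 * j
  N∸k m j k = NP.m+n∸n≡m (m + 2 * j) k

  N∸j : ∀ m j k → m + 2 * j + k ∸ j ≡ m + j + k
  N∸j m j k = trans (cong (_∸ j) (regroup m j k)) (NP.m+n∸n≡m (m + j + k) j)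
    where
    regroup : ∀ m j k → m + 2 * j + k ≡ m + j + k + j
    regroup = solve-∀

  N∸double : ∀ m j → m + 2 * j + 0 ∸ 2 * j ≡ m
  N∸double m j = trans (cong (_∸ 2 * j) (NP.+-identityʳ (m + 2 * j))) (NP.m+n∸n≡m m (2 * j))

  half-le : ∀ n j → j ≤ ⌊ n /2⌋ → 2 * j ≤ n
  half-le n zero h = z≤n
  half-le zero (suc j) ()
  half-le (suc zero) (suc j) ()
  half-le (suc (suc n)) (suc j) (s≤s h) = subst (_≤ suc (suc n)) (sym (double-suc j)) (s≤s (s≤s (half-le n j h)))

  half-ge : ∀ m j → j ≤ ⌊ (m + 2 * j) /2⌋
  half-ge m zero = z≤n
  half-ge m (suc j) = subst (λ z → suc j ≤ ⌊ z /2⌋) (sym (regroup m j)) (s≤s (half-ge m j))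
    where
    regroup : ∀ m j → m + 2 * suc j ≡ suc (suc (m + 2 * j))
    regroup = solve-∀

  shape-of-index : ∀ n k m j → k ≤ n → 2 * j ≤ n ∸ k → n ∸ k ∸ 2 * j ≡ m → n ≡ m + 2 * j + k
  shape-of-index n k m j hk hj e = sym (trans (cong (λ z → z + 2 * j + k) (sym e))
    (trans (cong (_+ k) (NP.m∸n+n≡m hj)) (NP.m∸n+n≡m hk)))

  index-unique : ∀ m j j' → 2 * j' ≤ m + 2 * j → m + 2 * j ∸ 2 * j' ≡ m → j' ≡ j
  index-unique m j j' hj e = sym (NP.*-cancelˡ-≡ j j' 2
    (NP.+-cancelˡ-≡ m (2 * j) (2 * j') (trans (sym (NP.m∸n+n≡m hj)) (cong (_+ 2 * j') e))))

  parity : ∀ d → (Σ ℕ λ j → d ≡ 2 * j) ⊎ (Σ ℕ λ j → d ≡ suc (2 * j))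
  parity zero = inj₁ (0 , refl)
  parity (suc d) with parity d
  ... | inj₁ (j , e) = inj₂ (j , cong suc e)
  ... | inj₂ (j , e) = inj₁ (suc j , trans (cong suc e) (sym (double-suc j)))

  odd≢even : ∀ a b → 2 * a ≢ suc (2 * b)
  odd≢even zero b ()
  odd≢even (suc a) zero h with NP.suc-injective (trans (sym (double-suc a)) h)
  ... | ()
  odd≢even (suc a) (suc b) h = odd≢even a b
    (NP.suc-injective (NP.suc-injective (trans (sym (double-suc a)) (trans h (cong suc (double-suc b))))))

  decide-shape : ∀ n k m → (Σ ℕ λ j → n ≡ m + 2 * j + k) ⊎ (∀ j → n ≢ m + 2 * j + k)
  decide-shape n k m with (m + k) ≤? n
  ... | no n<m+k = inj₂ (λ j e → n<m+k (subst (m + k ≤_) (sym e) (subst (m + k ≤_) (sym (swap m j k)) (NP.m≤m+n (m + k) (2 * j)))))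
    where
    swap : ∀ m j k → m + 2 * j + k ≡ m + k + 2 * j
    swap = solve-∀
  ... | yes m+k≤n with parity (n ∸ (m + k))
  ...   | inj₁ (j , e) = inj₁ (j , trans (sym (NP.m∸n+n≡m m+k≤n)) (trans (cong (_+ (m + k)) e) (swap m j k)))
    where
    swap : ∀ m j k → 2 * j + (m + k) ≡ m + 2 * j + k
    swap = solve-∀
  ...   | inj₂ (j₀ , e) = inj₂ (λ j h → odd≢even j j₀ (trans (sym (difference j h)) e))
    where
    swap : ∀ m j k → m + 2 * j + k ≡ 2 * j + (m + k)
    swap = solve-∀
    difference : ∀ j → n ≡ m + 2 * j + k → n ∸ (m + k) ≡ 2 * j
    difference j h = trans (cong (_∸ (m + k)) (trans h (swap m j k))) (NP.m+n∸n≡m (2 * j) (m + k))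

  shape-j⁻ : ∀ n m j k → suc n ≡ m + 2 * suc j + k → n ≡ suc m + 2 * j + k
  shape-j⁻ n m j k e = NP.suc-injective (trans e (N-suc-j m j k))

  shape-j⁺ : ∀ n m j k → n ≡ suc m + 2 * j + k → suc n ≡ m + 2 * suc j + k
  shape-j⁺ n m j k e = trans (cong suc e) (sym (N-suc-j m j k))

  shape-k⁻ : ∀ n m j k → suc n ≡ m + 2 * j + suc k → n ≡ m + 2 * j + k
  shape-k⁻ n m j k e = NP.suc-injective (trans e (N-suc-k m j k))

  shape-k⁺ : ∀ n m j k → n ≡ m + 2 * j + k → suc n ≡ m + 2 * j + suc k
  shape-k⁺ n m j k e = trans (cong suc e) (sym (N-suc-k m j k))

  shape-j0-clash : ∀ n m j k → suc n ≡ m + 2 * 0 + k → n ≡ suc m + 2 * j + k → ⊥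
  shape-j0-clash n m j k e1 e2 = NP.<⇒≢ (NP.m≤n⇒m≤1+n (s≤s (NP.m≤m+n (m + k) (2 * j))))
    (trans (sym (drop-zero m k)) (trans (sym e1) (trans (cong suc e2) (regroup m j k))))
    where
    drop-zero : ∀ m k → m + 2 * 0 + k ≡ m + k
    drop-zero = solve-∀
    regroup : ∀ m j k → suc (suc m + 2 * j + k) ≡ suc (suc (m + k + 2 * j))
    regroup = solve-∀

  shape-top : ∀ n m j → suc n ≡ m + 2 * j + suc n → (m ≡ 0) × (j ≡ 0)
  shape-top n m j e = NP.m+n≡0⇒m≡0 m m+2j≡0 , NP.*-cancelˡ-≡ j 0 2 (NP.m+n≡0⇒n≡0 m m+2j≡0)
    where
    m+2j≡0 : m + 2 * j ≡ 0
    m+2j≡0 = NP.+-cancelʳ-≡ (suc n) (m + 2 * j) 0 (sym e)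

module QNumbers where

  open KAlgebra
  open IndexArithmetic
  open import Data.Nat using (ℕ; zero; suc; _+_; _*_; _∸_)
  import Data.Nat.Properties as NP
  open import Data.List using ([]; _∷_; _++_)
  open import Relation.Binary.PropositionalEquality using (cong; sym; trans)
  open KR using () renaming (_-_ to _-K_)
  open KReason

  qpow : ℕ → K
  qpow e = powK qK e

  spow : ℕ → K
  spow j = powK sK j

  qint : ℕ → K
  qint a = embed (qnum a)

  qplus : ℕ → K
  qplus t = embed (onePlusQ t)

  qMinus1 : K
  qMinus1 = qK +K (-K 1K)

  qint⁻¹ : ℕ → K
  qint⁻¹ a = inv (qnumNZ a)

  qplus⁻¹ : ℕ → K
  qplus⁻¹ t = inv (onePlusQNZ t)

  qMinus1⁻¹ : K
  qMinus1⁻¹ = inv qMinus1NZ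

  -- the inverse laws (onePlusQNZ is defined by cases, hence the split)
  qint⁻¹-l : ∀ a → (qint⁻¹ a *K qint (suc a)) ≈k 1K
  qint⁻¹-l a = inv-l (qnumNZ a)

  qplus⁻¹-l : ∀ t → (qplus⁻¹ t *K qplus t) ≈k 1K
  qplus⁻¹-l zero = inv-l (onePlusQNZ zero)
  qplus⁻¹-l (suc t) = inv-l (onePlusQNZ (suc t))

  qMinus1⁻¹-l : (qMinus1⁻¹ *K qMinus1) ≈k 1K
  qMinus1⁻¹-l = KR.trans (qMinus1⁻¹ *≈ KR.sym (embed-+ P2.var (P2.neg P2.oneP))) (inv-l qMinus1NZ)

  qpow-+ : ∀ a b → qpow (a + b) ≈k (qpow a *K qpow b)
  qpow-+ zero b = KR.sym (KR.*-identityˡ (qpow b))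
  qpow-+ (suc a) b = begin
    qpow (a + b) *K qK        ≈⟨ qpow-+ a b ≈* qK ⟩
    (qpow a *K qpow b) *K qK  ≈⟨ SK.solve 3 (λ x y z → (x SK.:* y) SK.:* z SK.:= (x SK.:* z) SK.:* y) ≈k-refl (qpow a) (qpow b) qK ⟩
    (qpow a *K qK) *K qpow b  ∎

  qpow-+₃ : ∀ a b c → qpow (a + b + c) ≈k (qpow a *K qpow b *K qpow c)
  qpow-+₃ a b c = KR.trans (qpow-+ (a + b) c) (qpow-+ a b ≈* qpow c)

  qpow-N : ∀ m j k → qpow (m + 2 * j + k) ≈k (qpow m *K qpow j *K qpow j *K qpow k)
  qpow-N m j k = begin
    qpow (m + (j + (j + 0)) + k)             ≈⟨ qpow-+₃ m (j + (j + 0)) k ⟩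
    qpow m *K qpow (j + (j + 0)) *K qpow k   ≈⟨ (qpow m *≈ KR.trans (qpow-+ j (j + 0)) (qpow j *≈ ≡→≈ (cong qpow (NP.+-identityʳ j)))) ≈* qpow k ⟩
    qpow m *K (qpow j *K qpow j) *K qpow k   ≈⟨ KR.sym (KR.*-assoc (qpow m) (qpow j) (qpow j)) ≈* qpow k ⟩
    qpow m *K qpow j *K qpow j *K qpow k     ∎

  embed-varPow : ∀ t → embed (P2.varPow t) ≈k qpow t
  embed-varPow zero = ≈k-refl
  embed-varPow (suc t) = KR.trans (embed-shift (P2.varPow t)) (KR.trans (qK *≈ embed-varPow t) (KR.*-comm qK (qpow t)))

  qplus-qpow : ∀ t → qplus t ≈k (1K +K qpow t)
  qplus-qpow t = KR.trans (embed-+ P2.oneP (P2.varPow t)) (1K +≈ embed-varPow t)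

  qint-suc : ∀ a → qint (suc a) ≈k (1K +K (qK *K qint a))
  qint-suc a = KR.trans (embed-+ P2.oneP (P2.shift (qnum a))) (1K +≈ embed-shift (qnum a))

  qint-qMinus1 : ∀ a → (qint a *K qMinus1) ≈k (qpow a -K 1K)
  qint-qMinus1 zero = KR.trans (KR.zeroˡ qMinus1) (KR.sym (KR.-‿inverseʳ 1K))
  qint-qMinus1 (suc a) = begin
    qint (suc a) *K qMinus1               ≈⟨ qint-suc a ≈* qMinus1 ⟩
    (1K +K qK *K qint a) *K qMinus1       ≈⟨ SK.solve 3 (λ q e d → (one SK.:+ q SK.:* e) SK.:* d SK.:= d SK.:+ q SK.:* (e SK.:* d)) ≈k-refl qK (qint a) qMinus1 ⟩
    qMinus1 +K qK *K (qint a *K qMinus1)  ≈⟨ qMinus1 +≈ (qK *≈ qint-qMinus1 a) ⟩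
    qMinus1 +K qK *K (qpow a -K 1K)       ≈⟨ SK.solve 2 (λ q x → (q SK.:- one) SK.:+ q SK.:* (x SK.:- one) SK.:= x SK.:* q SK.:- one) ≈k-refl qK (qpow a) ⟩
    qpow a *K qK -K 1K                    ∎

  qint-+ : ∀ a b → qint (a + b) ≈k (qint a +K qpow a *K qint b)
  qint-+ zero b = KR.sym (KR.trans (KR.+-identityˡ (1K *K qint b)) (KR.*-identityˡ (qint b)))
  qint-+ (suc a) b = begin
    qint (suc (a + b))                                ≈⟨ qint-suc (a + b) ⟩
    1K +K qK *K qint (a + b)                          ≈⟨ 1K +≈ (qK *≈ qint-+ a b) ⟩
    1K +K qK *K (qint a +K qpow a *K qint b)
      ≈⟨ SK.solve 4 (λ q ea qa eb → one SK.:+ q SK.:* (ea SK.:+ qa SK.:* eb) SK.:= (one SK.:+ q SK.:* ea) SK.:+ (qa SK.:* q) SK.:* eb)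
           ≈k-refl qK (qint a) (qpow a) (qint b) ⟩
    (1K +K qK *K qint a) +K (qpow a *K qK) *K qint b  ≈⟨ KR.sym (qint-suc a) ≈+ ((qpow a *K qK) *K qint b) ⟩
    qint (suc a) +K qpow (suc a) *K qint b            ∎

  qint-double : ∀ a → qint (a + a) ≈k (qplus a *K qint a)
  qint-double a = begin
    qint (a + a)                ≈⟨ qint-+ a a ⟩
    qint a +K qpow a *K qint a  ≈⟨ SK.solve 2 (λ e q → e SK.:+ q SK.:* e SK.:= (one SK.:+ q) SK.:* e) ≈k-refl (qint a) (qpow a) ⟩
    (1K +K qpow a) *K qint a    ≈⟨ KR.sym (qplus-qpow a) ≈* qint a ⟩
    qplus a *K qint a           ∎

  -- The identity behind the coefficient recurrence, for n = m + 2j + k and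
  -- M = m + j + k:
  --   [n](1+q^M) = [m](1+q^(m+j)) + q^m [j](1+q^(j+k))(1+q^M) + q^(2m+j) [k](1+q^(j+k)).
  -- After multiplication by q - 1 it is a polynomial identity in A = q^m,
  -- B = q^j, C = q^k.
  three-term-poly : ∀ A B C →
    ((A *K B *K B *K C -K 1K) *K (1K +K A *K B *K C))
    ≈k (((A -K 1K) *K (1K +K A *K B))
        +K (A *K ((B -K 1K) *K (1K +K B *K C)) *K (1K +K A *K B *K C))
        +K (A *K A *K B *K ((C -K 1K) *K (1K +K B *K C))))
  three-term-poly = SK.solve 3 (λ A B C →
    (A SK.:* B SK.:* B SK.:* C SK.:- one) SK.:* (one SK.:+ A SK.:* B SK.:* C)
    SK.:= ((A SK.:- one) SK.:* (one SK.:+ A SK.:* B))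
          SK.:+ (A SK.:* ((B SK.:- one) SK.:* (one SK.:+ B SK.:* C)) SK.:* (one SK.:+ A SK.:* B SK.:* C))
          SK.:+ (A SK.:* A SK.:* B SK.:* ((C SK.:- one) SK.:* (one SK.:+ B SK.:* C)))) ≈k-refl

  qint-qplus-scaled : ∀ a b c → ((qint a *K qMinus1) *K qplus (b + c)) ≈k ((qpow a -K 1K) *K (1K +K qpow b *K qpow c))
  qint-qplus-scaled a b c = KR.*-cong (qint-qMinus1 a) (KR.trans (qplus-qpow (b + c)) (1K +≈ qpow-+ b c))

  three-term : ∀ m j k →
    (qint (m + 2 * j + k) *K qplus (m + j + k))
    ≈k ((qint m *K qplus (m + j))
        +K (qpow m *K qint j *K qplus (j + k) *K qplus (m + j + k))
        +K (qpow (m + m + j) *K qint k *K qplus (j + k)))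
  three-term m j k = cancel-unit qMinus1 qMinus1⁻¹ qMinus1⁻¹-l (begin
      (qint N *K qplus M) *K qMinus1
        ≈⟨ SK.solve 3 (λ e g d → (e SK.:* g) SK.:* d SK.:= (e SK.:* d) SK.:* g) ≈k-refl (qint N) (qplus M) qMinus1 ⟩
      (qint N *K qMinus1) *K qplus M
        ≈⟨ KR.*-cong (qint-qMinus1 N) (qplus-qpow M) ⟩
      (qpow N -K 1K) *K (1K +K qpow M)
        ≈⟨ KR.*-cong (qpow-N m j k ≈+ (-K 1K)) (1K +≈ qpow-+₃ m j k) ⟩
      (A *K B *K B *K C -K 1K) *K (1K +K A *K B *K C)
        ≈⟨ three-term-poly A B C ⟩
      ((A -K 1K) *K (1K +K A *K B))
        +K (A *K ((B -K 1K) *K (1K +K B *K C)) *K (1K +K A *K B *K C))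
        +K (A *K A *K B *K ((C -K 1K) *K (1K +K B *K C)))
        ≈⟨ KR.sym (KR.+-cong (KR.+-cong (qint-qplus-scaled m m j)
                                        (KR.*-cong (A *≈ qint-qplus-scaled j j k) (KR.trans (qplus-qpow M) (1K +≈ qpow-+₃ m j k))))
                             (KR.*-cong (qpow-+₃ m m j) (qint-qplus-scaled k j k))) ⟩
      ((qint m *K qMinus1) *K qplus (m + j))
        +K (qpow m *K ((qint j *K qMinus1) *K qplus (j + k)) *K qplus M)
        +K (qpow (m + m + j) *K ((qint k *K qMinus1) *K qplus (j + k)))
        ≈⟨ SK.solve 9 (λ em gmj a ej gjk gM qmmj ek d →
                (em SK.:* d SK.:* gmj) SK.:+ (a SK.:* (ej SK.:* d SK.:* gjk) SK.:* gM) SK.:+ (qmmj SK.:* (ek SK.:* d SK.:* gjk))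
                SK.:= ((em SK.:* gmj) SK.:+ (a SK.:* ej SK.:* gjk SK.:* gM) SK.:+ (qmmj SK.:* ek SK.:* gjk)) SK.:* d)
             ≈k-refl (qint m) (qplus (m + j)) (qpow m) (qint j) (qplus (j + k)) (qplus M) (qpow (m + m + j)) (qint k) qMinus1 ⟩
      ((qint m *K qplus (m + j)) +K (qpow m *K qint j *K qplus (j + k) *K qplus M)
        +K (qpow (m + m + j) *K qint k *K qplus (j + k))) *K qMinus1 ∎)
    where
    N = m + 2 * j + k
    M = m + j + k
    A = qpow m
    B = qpow j
    C = qpow k

  qfacK : ℕ → K
  qfacK zero = 1K
  qfacK (suc a) = qfacK a *K qint (suc a)

  qfacK⁻¹ : ℕ → K
  qfacK⁻¹ zero = 1K
  qfacK⁻¹ (suc a) = qfacK⁻¹ a *K qint⁻¹ a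

  plusFac : ℕ → K
  plusFac zero = 1K
  plusFac (suc a) = plusFac a *K qplus (suc a)

  plusFac⁻¹ : ℕ → K
  plusFac⁻¹ zero = 1K
  plusFac⁻¹ (suc a) = plusFac⁻¹ a *K qplus⁻¹ (suc a)

  oddFacK : ℕ → K
  oddFacK j = embed (oddFact j)

  qfacK⁻¹-l : ∀ a → (qfacK⁻¹ a *K qfacK a) ≈k 1K
  qfacK⁻¹-l zero = KR.*-identityʳ 1K
  qfacK⁻¹-l (suc a) = KR.trans (*-interchange (qfacK⁻¹ a) (qint⁻¹ a) (qfacK a) (qint (suc a)))
    (drop-units (KR.sym (KR.*-identityˡ _)) (qfacK⁻¹-l a) (qint⁻¹-l a))

  plusFac⁻¹-l : ∀ a → (plusFac⁻¹ a *K plusFac a) ≈k 1K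
  plusFac⁻¹-l zero = KR.*-identityʳ 1K
  plusFac⁻¹-l (suc a) = KR.trans (*-interchange (plusFac⁻¹ a) (qplus⁻¹ (suc a)) (plusFac a) (qplus (suc a)))
    (drop-units (KR.sym (KR.*-identityˡ _)) (plusFac⁻¹-l a) (qplus⁻¹-l (suc a)))

  qfacK-embed : ∀ a → qfacK a ≈k embed (qfact a)
  qfacK-embed zero = ≈k-refl
  qfacK-embed (suc a) = qfacK-embed a ≈* qint (suc a)

  qfacK⁻¹-invList : ∀ a → qfacK⁻¹ a ≈k invList (qfactNZs a)
  qfacK⁻¹-invList zero = ≈k-refl
  qfacK⁻¹-invList (suc a) = KR.trans (qfacK⁻¹-invList a ≈* qint⁻¹ a) (KR.sym (invList-++ (qfactNZs a) (qnumNZ a ∷ [])))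

  plusFac⁻¹-invList : ∀ a → plusFac⁻¹ a ≈k invList (onePlusQNZs a)
  plusFac⁻¹-invList zero = ≈k-refl
  plusFac⁻¹-invList (suc a) =
    KR.trans (plusFac⁻¹-invList a ≈* qplus⁻¹ (suc a)) (KR.sym (invList-++ (onePlusQNZs a) (onePlusQNZ (suc a) ∷ [])))

  qbin-qfac : ∀ n k → qbinK n k ≈k (qfacK n *K qfacK⁻¹ k *K qfacK⁻¹ (n ∸ k))
  qbin-qfac n k = begin
    qbinK n k
      ≈⟨ frac-split (qfact n) (qfactNZs k ++ qfactNZs (n ∸ k)) ⟩
    embed (qfact n) *K invList (qfactNZs k ++ qfactNZs (n ∸ k))
      ≈⟨ KR.*-cong (KR.sym (qfacK-embed n)) (invList-++ (qfactNZs k) (qfactNZs (n ∸ k))) ⟩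
    qfacK n *K (invList (qfactNZs k) *K invList (qfactNZs (n ∸ k)))
      ≈⟨ qfacK n *≈ KR.*-cong (KR.sym (qfacK⁻¹-invList k)) (KR.sym (qfacK⁻¹-invList (n ∸ k))) ⟩
    qfacK n *K (qfacK⁻¹ k *K qfacK⁻¹ (n ∸ k))
      ≈⟨ KR.sym (KR.*-assoc (qfacK n) (qfacK⁻¹ k) (qfacK⁻¹ (n ∸ k))) ⟩
    qfacK n *K qfacK⁻¹ k *K qfacK⁻¹ (n ∸ k) ∎

  -- [2j]! = [2j-1]!! P(j) [j]!, since [2i] = (1+q^i)[i]
  qfacK-double : ∀ j → qfacK (2 * j) ≈k (oddFacK j *K plusFac j *K qfacK j)
  qfacK-double zero = KR.sym (KR.trans (KR.*-identityʳ (1K *K 1K)) (KR.*-identityʳ 1K))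
  qfacK-double (suc j) = begin
    qfacK (2 * suc j)
      ≈⟨ ≡→≈ (cong qfacK (double-suc j)) ⟩
    qfacK (2 * j) *K qint (suc (2 * j)) *K qint (suc (suc (2 * j)))
      ≈⟨ KR.*-cong (qfacK-double j ≈* qint (suc (2 * j))) (KR.trans (≡→≈ (cong qint (double-suc′ j))) (qint-double (suc j))) ⟩
    oddFacK j *K plusFac j *K qfacK j *K qint (suc (2 * j)) *K (qplus (suc j) *K qint (suc j))
      ≈⟨ SK.solve 6 (λ o p f e g e' → o SK.:* p SK.:* f SK.:* e SK.:* (g SK.:* e') SK.:= (o SK.:* e) SK.:* (p SK.:* g) SK.:* (f SK.:* e'))
           ≈k-refl (oddFacK j) (plusFac j) (qfacK j) (qint (suc (2 * j))) (qplus (suc j)) (qint (suc j)) ⟩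
    (oddFacK j *K qint (suc (2 * j))) *K (plusFac j *K qplus (suc j)) *K (qfacK j *K qint (suc j))
      ≈⟨ (oddFacK j *≈ KR.sym (≡→≈ (cong qint (NP.+-comm (2 * j) 1)))) ≈* (plusFac j *K qplus (suc j)) ≈* (qfacK j *K qint (suc j)) ⟩
    oddFacK (suc j) *K plusFac (suc j) *K qfacK (suc j) ∎

  qfacK⁻¹-double : ∀ j → (qfacK⁻¹ (2 * j) *K oddFacK j) ≈k (plusFac⁻¹ j *K qfacK⁻¹ j)
  qfacK⁻¹-double j = KR.sym (begin
    plusFac⁻¹ j *K qfacK⁻¹ j
      ≈⟨ KR.sym (KR.*-identityˡ _) ⟩
    1K *K (plusFac⁻¹ j *K qfacK⁻¹ j)
      ≈⟨ KR.sym (qfacK⁻¹-l (2 * j)) ≈* (plusFac⁻¹ j *K qfacK⁻¹ j) ⟩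
    (qfacK⁻¹ (2 * j) *K qfacK (2 * j)) *K (plusFac⁻¹ j *K qfacK⁻¹ j)
      ≈⟨ (qfacK⁻¹ (2 * j) *≈ qfacK-double j) ≈* (plusFac⁻¹ j *K qfacK⁻¹ j) ⟩
    (qfacK⁻¹ (2 * j) *K (oddFacK j *K plusFac j *K qfacK j)) *K (plusFac⁻¹ j *K qfacK⁻¹ j)
      ≈⟨ SK.solve 6 (λ i o p f ip if → (i SK.:* (o SK.:* p SK.:* f)) SK.:* (ip SK.:* if) SK.:= (i SK.:* o) SK.:* ((ip SK.:* p) SK.:* (if SK.:* f)))
           ≈k-refl (qfacK⁻¹ (2 * j)) (oddFacK j) (plusFac j) (qfacK j) (plusFac⁻¹ j) (qfacK⁻¹ j) ⟩
    (qfacK⁻¹ (2 * j) *K oddFacK j) *K ((plusFac⁻¹ j *K plusFac j) *K (qfacK⁻¹ j *K qfacK j))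
      ≈⟨ drop-units ≈k-refl (plusFac⁻¹-l j) (qfacK⁻¹-l j) ⟩
    qfacK⁻¹ (2 * j) *K oddFacK j ∎)

  prod-qplus : ∀ k b → prodK k (λ i → qplus (b + k ∸ i)) ≈k (plusFac (b + k) *K plusFac⁻¹ b)
  prod-qplus zero b = begin
    1K                          ≈⟨ KR.sym (KR.trans (KR.*-comm (plusFac b) (plusFac⁻¹ b)) (plusFac⁻¹-l b)) ⟩
    plusFac b *K plusFac⁻¹ b    ≈⟨ ≡→≈ (cong plusFac (sym (NP.+-identityʳ b))) ≈* plusFac⁻¹ b ⟩
    plusFac (b + 0) *K plusFac⁻¹ b ∎
  prod-qplus (suc k) b = begin
    prodK k (λ i → qplus (b + suc k ∸ i)) *K qplus (b + suc k ∸ k)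
      ≈⟨ KR.*-cong (prodK-cong k (λ i → ≡→≈ (cong (λ z → qplus (z ∸ i)) (NP.+-suc b k))))
                   (≡→≈ (cong (λ z → qplus (z ∸ k)) (NP.+-suc b k))) ⟩
    prodK k (λ i → qplus (suc b + k ∸ i)) *K qplus (suc b + k ∸ k)
      ≈⟨ KR.*-cong (prod-qplus k (suc b)) (≡→≈ (cong qplus (NP.m+n∸n≡m (suc b) k))) ⟩
    plusFac (suc b + k) *K (plusFac⁻¹ b *K qplus⁻¹ (suc b)) *K qplus (suc b)
      ≈⟨ drop-unit (SK.solve 4 (λ p ip ig g → p SK.:* (ip SK.:* ig) SK.:* g SK.:= (p SK.:* ip) SK.:* (ig SK.:* g))
                      ≈k-refl (plusFac (suc b + k)) (plusFac⁻¹ b) (qplus⁻¹ (suc b)) (qplus (suc b)))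
                   (qplus⁻¹-l (suc b)) ⟩
    plusFac (suc b + k) *K plusFac⁻¹ b
      ≈⟨ ≡→≈ (cong plusFac (sym (NP.+-suc b k))) ≈* plusFac⁻¹ b ⟩
    plusFac (b + suc k) *K plusFac⁻¹ b ∎

  prod-qplus⁻¹ : ∀ k j → prodK k (λ i → qplus⁻¹ (j + 1 + i)) ≈k (plusFac j *K plusFac⁻¹ (j + k))
  prod-qplus⁻¹ zero j = begin
    1K                        ≈⟨ KR.sym (KR.trans (KR.*-comm (plusFac j) (plusFac⁻¹ j)) (plusFac⁻¹-l j)) ⟩
    plusFac j *K plusFac⁻¹ j  ≈⟨ plusFac j *≈ ≡→≈ (cong plusFac⁻¹ (sym (NP.+-identityʳ j))) ⟩
    plusFac j *K plusFac⁻¹ (j + 0) ∎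
  prod-qplus⁻¹ (suc k) j = begin
    prodK k (λ i → qplus⁻¹ (j + 1 + i)) *K qplus⁻¹ (j + 1 + k)
      ≈⟨ KR.*-cong (prod-qplus⁻¹ k j) (≡→≈ (cong qplus⁻¹ (j+1+i j k))) ⟩
    plusFac j *K plusFac⁻¹ (j + k) *K qplus⁻¹ (suc (j + k))
      ≈⟨ KR.*-assoc (plusFac j) (plusFac⁻¹ (j + k)) (qplus⁻¹ (suc (j + k))) ⟩
    plusFac j *K plusFac⁻¹ (suc (j + k))
      ≈⟨ plusFac j *≈ ≡→≈ (cong plusFac⁻¹ (sym (NP.+-suc j k))) ⟩
    plusFac j *K plusFac⁻¹ (j + suc k) ∎

-- Multiplying by
-- [n+1](1+q^(m+j+k)), each term becomes coef m j k times one of the three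
-- summands of three-term.
module CoefficientRecurrence where

  open KAlgebra
  open QNumbers
  open IndexArithmetic
  open import Data.Nat using (ℕ; zero; suc; _+_; _*_)
  import Data.Nat.Properties as NP
  open import Relation.Binary.PropositionalEquality using (_≡_; cong; sym; trans)
  open KReason

  coef : ℕ → ℕ → ℕ → K
  coef m j k = spow j *K qpow (qExp j k) *K qfacK (m + 2 * j + k) *K plusFac (m + j + k)
               *K qfacK⁻¹ k *K qfacK⁻¹ m *K qfacK⁻¹ j *K plusFac⁻¹ (m + j) *K plusFac⁻¹ (j + k)

  coef-suc-j : ∀ m j k → coef m (suc j) k ≈k
    ((spow j *K sK) *K (qpow (qExp j k) *K qpow (suc (2 * j + k))) *K (qfacK (suc (m + 2 * j + k)) *K qint (suc (suc (m + 2 * j + k))))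
     *K plusFac (suc (m + j + k)) *K qfacK⁻¹ k *K qfacK⁻¹ m *K (qfacK⁻¹ j *K qint⁻¹ j) *K plusFac⁻¹ (suc (m + j))
     *K (plusFac⁻¹ (j + k) *K qplus⁻¹ (suc (j + k))))
  coef-suc-j m j k = *-cong₉ (≈refl (spow (suc j))) (KR.trans (≡→≈ (cong qpow (qExp-suc-j j k))) (qpow-+ (qExp j k) (suc (2 * j + k))))
    (≡→≈ (cong qfacK (N-suc-j m j k))) (≡→≈ (cong plusFac (M-suc-j m j k))) (≈refl (qfacK⁻¹ k)) (≈refl (qfacK⁻¹ m))
    (≈refl (qfacK⁻¹ (suc j))) (≡→≈ (cong plusFac⁻¹ (NP.+-suc m j))) (≈refl (plusFac⁻¹ (suc j + k)))

  coef-suc-k : ∀ m j k → coef m j (suc k) ≈k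
    (spow j *K (qpow (qExp j k) *K qpow (j + k)) *K (qfacK (m + 2 * j + k) *K qint (suc (m + 2 * j + k)))
     *K (plusFac (m + j + k) *K qplus (suc (m + j + k))) *K (qfacK⁻¹ k *K qint⁻¹ k) *K qfacK⁻¹ m *K qfacK⁻¹ j
     *K plusFac⁻¹ (m + j) *K (plusFac⁻¹ (j + k) *K qplus⁻¹ (suc (j + k))))
  coef-suc-k m j k = *-cong₉ (≈refl (spow j)) (KR.trans (≡→≈ (cong qpow (qExp-suc-k j k))) (qpow-+ (qExp j k) (j + k)))
    (≡→≈ (cong qfacK (N-suc-k m j k))) (≡→≈ (cong plusFac (M-suc-k m j k))) (≈refl (qfacK⁻¹ (suc k))) (≈refl (qfacK⁻¹ m))
    (≈refl (qfacK⁻¹ j)) (≈refl (plusFac⁻¹ (m + j))) (≡→≈ (cong plusFac⁻¹ (NP.+-suc j k)))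

  termX-rel : ∀ m j k → ((qint (suc m + 2 * j + k) *K qplus (suc m + j + k)) *K coef m j k)
                    ≈k (coef (suc m) j k *K (qint (suc m) *K qplus (suc m + j)))
  termX-rel m j k = KR.sym (drop-units (SK.solve 15
    (λ sp qe f en p g a b ie c d ig e em gmj →
       (sp SK.:* qe SK.:* (f SK.:* en) SK.:* (p SK.:* g) SK.:* a SK.:* (b SK.:* ie) SK.:* c SK.:* (d SK.:* ig) SK.:* e) SK.:* (em SK.:* gmj)
       SK.:= ((en SK.:* g) SK.:* (sp SK.:* qe SK.:* f SK.:* p SK.:* a SK.:* b SK.:* c SK.:* d SK.:* e)) SK.:* ((ie SK.:* em) SK.:* (ig SK.:* gmj)))
    ≈k-refl (spow j) (qpow (qExp j k)) (qfacK (m + 2 * j + k)) (qint (suc (m + 2 * j + k))) (plusFac (m + j + k)) (qplus (suc (m + j + k)))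
            (qfacK⁻¹ k) (qfacK⁻¹ m) (qint⁻¹ m) (qfacK⁻¹ j) (plusFac⁻¹ (m + j)) (qplus⁻¹ (suc (m + j))) (plusFac⁻¹ (j + k))
            (qint (suc m)) (qplus (suc (m + j))))
    (qint⁻¹-l m) (qplus⁻¹-l (suc (m + j))))

  termD-rel : ∀ n m j k → suc n ≡ m + 2 * suc j + k →
    ((qint (m + 2 * suc j + k) *K qplus (m + suc j + k)) *K (qpow n *K sK *K qint (suc m) *K coef (suc m) j k))
    ≈k (coef m (suc j) k *K (qpow m *K qint (suc j) *K qplus (suc j + k) *K qplus (m + suc j + k)))
  termD-rel n m j k hn = begin
    (qint (m + 2 * suc j + k) *K qplus (m + suc j + k)) *K (qpow n *K sK *K qint (suc m) *K coef (suc m) j k)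
      ≈⟨ KR.*-cong (KR.*-cong (≡→≈ (cong qint (N-suc-j m j k))) (≡→≈ (cong qplus (M-suc-j m j k))))
                   (((KR.trans (≡→≈ (cong qpow (n-suc-j n m j k hn))) (qpow-+ m (suc (2 * j + k))) ≈* sK) ≈* qint (suc m)) ≈* coef (suc m) j k) ⟩
    (e2 *K g1) *K (qm *K qx *K sK *K em1 *K coef (suc m) j k)
      ≈⟨ drop-unit (SK.solve 16
           (λ e2 g1 qm qx s em1 sp qe f1 p1 a b iem c d e →
             (e2 SK.:* g1) SK.:* (qm SK.:* qx SK.:* s SK.:* em1 SK.:* (sp SK.:* qe SK.:* f1 SK.:* p1 SK.:* a SK.:* (b SK.:* iem) SK.:* c SK.:* d SK.:* e))
             SK.:= (e2 SK.:* g1 SK.:* qm SK.:* qx SK.:* s SK.:* sp SK.:* qe SK.:* f1 SK.:* p1 SK.:* a SK.:* b SK.:* c SK.:* d SK.:* e) SK.:* (iem SK.:* em1))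
           ≈k-refl e2 g1 qm qx sK em1 (spow j) (qpow (qExp j k)) f1 p1 (qfacK⁻¹ k) (qfacK⁻¹ m) (qint⁻¹ m) (qfacK⁻¹ j)
                   (plusFac⁻¹ (suc (m + j))) (plusFac⁻¹ (j + k)))
           (qint⁻¹-l m) ⟩
    e2 *K g1 *K qm *K qx *K sK *K spow j *K qpow (qExp j k) *K f1 *K p1 *K qfacK⁻¹ k *K qfacK⁻¹ m *K qfacK⁻¹ j
       *K plusFac⁻¹ (suc (m + j)) *K plusFac⁻¹ (j + k)
      ≈⟨ KR.sym (drop-units (SK.solve 18
           (λ e2 g1 qm qx s sp qe f1 p1 a b c d e iej ej1 ig gjk →
             ((sp SK.:* s) SK.:* (qe SK.:* qx) SK.:* (f1 SK.:* e2) SK.:* p1 SK.:* a SK.:* b SK.:* (c SK.:* iej) SK.:* d SK.:* (e SK.:* ig)) SK.:* (qm SK.:* ej1 SK.:* gjk SK.:* g1)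
             SK.:= (e2 SK.:* g1 SK.:* qm SK.:* qx SK.:* s SK.:* sp SK.:* qe SK.:* f1 SK.:* p1 SK.:* a SK.:* b SK.:* c SK.:* d SK.:* e) SK.:* ((iej SK.:* ej1) SK.:* (ig SK.:* gjk)))
           ≈k-refl e2 g1 qm qx sK (spow j) (qpow (qExp j k)) f1 p1 (qfacK⁻¹ k) (qfacK⁻¹ m) (qfacK⁻¹ j) (plusFac⁻¹ (suc (m + j)))
                   (plusFac⁻¹ (j + k)) (qint⁻¹ j) (qint (suc j)) (qplus⁻¹ (suc (j + k))) (qplus (suc (j + k))))
           (qint⁻¹-l j) (qplus⁻¹-l (suc (j + k)))) ⟩
    unfolded *K (qm *K qint (suc j) *K qplus (suc (j + k)) *K g1)
      ≈⟨ KR.*-cong (KR.sym (coef-suc-j m j k)) (qm *K qint (suc j) *K qplus (suc (j + k)) *≈ KR.sym (≡→≈ (cong qplus (M-suc-j m j k)))) ⟩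
    coef m (suc j) k *K (qpow m *K qint (suc j) *K qplus (suc j + k) *K qplus (m + suc j + k)) ∎
    where
    e2 = qint (suc (suc (m + 2 * j + k)))
    g1 = qplus (suc (m + j + k))
    qm = qpow m
    qx = qpow (suc (2 * j + k))
    em1 = qint (suc m)
    f1 = qfacK (suc (m + 2 * j + k))
    p1 = plusFac (suc (m + j + k))
    unfolded = (spow j *K sK) *K (qpow (qExp j k) *K qx) *K (f1 *K e2) *K p1 *K qfacK⁻¹ k *K qfacK⁻¹ m
               *K (qfacK⁻¹ j *K qint⁻¹ j) *K plusFac⁻¹ (suc (m + j)) *K (plusFac⁻¹ (j + k) *K qplus⁻¹ (suc (j + k)))

  termS-rel : ∀ n m j k → suc n ≡ m + 2 * j + suc k →
    ((qint (m + 2 * j + suc k) *K qplus (m + j + suc k)) *K (qpow n *K qpow m *K coef m j k))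
    ≈k (coef m j (suc k) *K (qpow (m + m + j) *K qint (suc k) *K qplus (j + suc k)))
  termS-rel n m j k hn = begin
    (qint (m + 2 * j + suc k) *K qplus (m + j + suc k)) *K (qpow n *K qpow m *K coef m j k)
      ≈⟨ KR.*-cong (KR.*-cong (≡→≈ (cong qint (N-suc-k m j k))) (≡→≈ (cong qplus (M-suc-k m j k)))) (exponent ≈* coef m j k) ⟩
    (en *K g1) *K (qjk *K qmmj *K coef m j k)
      ≈⟨ KR.sym (drop-units (SK.solve 17
           (λ en g1 qjk qmmj sp qe f0 p0 a b c d e iek ek1 ig gjk →
             (sp SK.:* (qe SK.:* qjk) SK.:* (f0 SK.:* en) SK.:* (p0 SK.:* g1) SK.:* (a SK.:* iek) SK.:* b SK.:* c SK.:* d SK.:* (e SK.:* ig)) SK.:* (qmmj SK.:* ek1 SK.:* gjk)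
             SK.:= ((en SK.:* g1) SK.:* (qjk SK.:* qmmj SK.:* (sp SK.:* qe SK.:* f0 SK.:* p0 SK.:* a SK.:* b SK.:* c SK.:* d SK.:* e))) SK.:* ((iek SK.:* ek1) SK.:* (ig SK.:* gjk)))
           ≈k-refl en g1 qjk qmmj (spow j) (qpow (qExp j k)) f0 p0 (qfacK⁻¹ k) (qfacK⁻¹ m) (qfacK⁻¹ j) (plusFac⁻¹ (m + j)) (plusFac⁻¹ (j + k))
                   (qint⁻¹ k) (qint (suc k)) (qplus⁻¹ (suc (j + k))) (qplus (suc (j + k))))
           (qint⁻¹-l k) (qplus⁻¹-l (suc (j + k)))) ⟩
    unfolded *K (qmmj *K qint (suc k) *K qplus (suc (j + k)))
      ≈⟨ KR.*-cong (KR.sym (coef-suc-k m j k)) (qmmj *K qint (suc k) *≈ KR.sym (≡→≈ (cong qplus (NP.+-suc j k)))) ⟩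
    coef m j (suc k) *K (qpow (m + m + j) *K qint (suc k) *K qplus (j + suc k)) ∎
    where
    en = qint (suc (m + 2 * j + k))
    g1 = qplus (suc (m + j + k))
    qjk = qpow (j + k)
    qmmj = qpow (m + m + j)
    f0 = qfacK (m + 2 * j + k)
    p0 = plusFac (m + j + k)
    unfolded = spow j *K (qpow (qExp j k) *K qjk) *K (f0 *K en) *K (p0 *K g1) *K (qfacK⁻¹ k *K qint⁻¹ k) *K qfacK⁻¹ m
               *K qfacK⁻¹ j *K plusFac⁻¹ (m + j) *K (plusFac⁻¹ (j + k) *K qplus⁻¹ (suc (j + k)))
    exponent : (qpow n *K qpow m) ≈k (qjk *K qmmj)
    exponent = KR.trans (KR.sym (qpow-+ n m)) (KR.trans (≡→≈ (cong qpow (n+m-suc-k n m j k hn))) (qpow-+ (j + k) (m + m + j)))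

  termX : ℕ → ℕ → ℕ → K
  termX zero j k = 0K
  termX (suc m) j k = coef m j k

  termD : ℕ → ℕ → ℕ → ℕ → K
  termD n m zero k = 0K
  termD n m (suc j) k = qpow n *K sK *K qint (suc m) *K coef (suc m) j k

  termS : ℕ → ℕ → ℕ → ℕ → K
  termS n m j zero = 0K
  termS n m j (suc k) = qpow n *K qpow m *K coef m j k

  -- an absent term matches a summand of three-term containing the factor [0] = 0
  absent : ∀ W C R → R ≈k 0K → (W *K 0K) ≈k (C *K R)
  absent W C R R0 = KR.trans (KR.zeroʳ W) (KR.sym (KR.trans (C *≈ R0) (KR.zeroʳ C)))

  zero-middle : ∀ a b → (a *K 0K *K b) ≈k 0K
  zero-middle a b = KR.trans (KR.zeroʳ a ≈* b) (KR.zeroˡ b)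

  termX-weighted : ∀ m j k → ((qint (m + 2 * j + k) *K qplus (m + j + k)) *K termX m j k)
                             ≈k (coef m j k *K (qint m *K qplus (m + j)))
  termX-weighted zero j k = absent (qint (2 * j + k) *K qplus (j + k)) (coef zero j k) (qint zero *K qplus j) (KR.zeroˡ (qplus j))
  termX-weighted (suc m) j k = termX-rel m j k

  termD-weighted : ∀ n m j k → suc n ≡ m + 2 * j + k →
                   ((qint (m + 2 * j + k) *K qplus (m + j + k)) *K termD n m j k)
                   ≈k (coef m j k *K (qpow m *K qint j *K qplus (j + k) *K qplus (m + j + k)))
  termD-weighted n m zero k h = absent (qint (m + 2 * zero + k) *K qplus (m + zero + k)) (coef m zero k)
    (qpow m *K qint zero *K qplus k *K qplus (m + zero + k))
    (KR.trans (zero-middle (qpow m) (qplus k) ≈* qplus (m + zero + k)) (KR.zeroˡ (qplus (m + zero + k))))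
  termD-weighted n m (suc j) k h = termD-rel n m j k h

  termS-weighted : ∀ n m j k → suc n ≡ m + 2 * j + k →
                   ((qint (m + 2 * j + k) *K qplus (m + j + k)) *K termS n m j k)
                   ≈k (coef m j k *K (qpow (m + m + j) *K qint k *K qplus (j + k)))
  termS-weighted n m j zero h = absent (qint (m + 2 * j + zero) *K qplus (m + j + zero)) (coef m j zero)
    (qpow (m + m + j) *K qint zero *K qplus (j + zero)) (zero-middle (qpow (m + m + j)) (qplus (j + zero)))
  termS-weighted n m j (suc k) h = termS-rel n m j k h

  -- the recurrence: multiply by the unit W = [n+1](1+q^M) and use three-term
  coef-recurrence : ∀ n m j k → suc n ≡ m + 2 * j + k → coef m j k ≈k (termX m j k +K termD n m j k +K termS n m j k)
  coef-recurrence n m j k hn = cancel-unit W W⁻¹ W⁻¹-l weighted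
    where
    N = m + 2 * j + k
    M = m + j + k
    W = qint N *K qplus M
    W⁻¹ = qint⁻¹ n *K qplus⁻¹ M
    W⁻¹-l : (W⁻¹ *K W) ≈k 1K
    W⁻¹-l = begin
      W⁻¹ *K W                                                ≈⟨ W⁻¹ *≈ (≡→≈ (cong qint (sym hn)) ≈* qplus M) ⟩
      (qint⁻¹ n *K qplus⁻¹ M) *K (qint (suc n) *K qplus M)    ≈⟨ *-interchange (qint⁻¹ n) (qplus⁻¹ M) (qint (suc n)) (qplus M) ⟩
      (qint⁻¹ n *K qint (suc n)) *K (qplus⁻¹ M *K qplus M)    ≈⟨ drop-units (KR.sym (KR.*-identityˡ _)) (qint⁻¹-l n) (qplus⁻¹-l M) ⟩
      1K                                                      ∎
    C = coef m j k
    R1 = qint m *K qplus (m + j)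
    R2 = qpow m *K qint j *K qplus (j + k) *K qplus M
    R3 = qpow (m + m + j) *K qint k *K qplus (j + k)
    weighted : (C *K W) ≈k ((termX m j k +K termD n m j k +K termS n m j k) *K W)
    weighted = begin
      C *K W
        ≈⟨ C *≈ three-term m j k ⟩
      C *K (R1 +K R2 +K R3)
        ≈⟨ SK.solve 4 (λ c a b d → c SK.:* (a SK.:+ b SK.:+ d) SK.:= c SK.:* a SK.:+ c SK.:* b SK.:+ c SK.:* d) ≈k-refl C R1 R2 R3 ⟩
      C *K R1 +K C *K R2 +K C *K R3
        ≈⟨ KR.sym (KR.+-cong (KR.+-cong (termX-weighted m j k) (termD-weighted n m j k hn)) (termS-weighted n m j k hn)) ⟩
      W *K termX m j k +K W *K termD n m j k +K W *K termS n m j k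
        ≈⟨ SK.solve 4 (λ w a b d → w SK.:* a SK.:+ w SK.:* b SK.:+ w SK.:* d SK.:= (a SK.:+ b SK.:+ d) SK.:* w)
                      ≈k-refl W (termX m j k) (termD n m j k) (termS n m j k) ⟩
      (termX m j k +K termD n m j k +K termS n m j k) *K W ∎

module KPolynomials where

  open KAlgebra
  open import Data.Nat using (ℕ; zero; suc; _≤_; z≤n; s≤s; _≟_)
  import Data.Nat.Properties as NP
  open import Data.List using ([]; _∷_)
  open import Data.Empty using (⊥-elim)
  open import Data.Maybe using (nothing)
  open import Relation.Binary.PropositionalEquality using (_≡_; _≢_; refl; cong; sym)
  open import Relation.Nullary using (yes; no)
  open import Tactic.RingSolver.Core.AlmostCommutativeRing using (fromCommutativeRing)
  import Tactic.RingSolver.NonReflective as NonReflective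
  import Relation.Binary.Reasoning.Setoid as SetoidReasoning
  open KX using (_≐_; mk; ≐-refl; ≐-sym; ≐-trans) renaming (_⊕_ to _⊕X_; _⊗_ to _⊗X_)

  module SX = NonReflective (fromCommutativeRing KX.polyRing (λ _ → nothing))
  module XR = SetoidReasoning KX.≐-setoid

  toK : ∀ {x y} → x ≈k y → x ≈K y
  toK h = Zqs.get (getK h)

  fromK : ∀ {x y} → x ≈K y → x ≈k y
  fromK h = mkK (Zqs.mk h)

  coeffEq : ∀ {p r} → (∀ i → PX.coeff p i ≈k PX.coeff r i) → p ≐ r
  coeffEq h = mk λ i → toK (h i)

  coeffOf : ∀ {p r} → p ≐ r → ∀ i → PX.coeff p i ≈k PX.coeff r i
  coeffOf (mk h) i = fromK (h i)

  coeff-scaleK : ∀ c p i → PX.coeff (PX.scale c p) i ≈k (c *K PX.coeff p i)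
  coeff-scaleK c p i = fromK {PX.coeff (PX.scale c p) i} {c *K PX.coeff p i} (KX.coeff-scale c p i)

  coeff-⊕K : ∀ p r i → PX.coeff (p ⊕X r) i ≈k (PX.coeff p i +K PX.coeff r i)
  coeff-⊕K p r i = fromK {PX.coeff (p ⊕X r) i} {PX.coeff p i +K PX.coeff r i} (KX.coeff-⊕ p r i)

  coeff-negK : ∀ p i → PX.coeff (PX.neg p) i ≈k (-K PX.coeff p i)
  coeff-negK p i = fromK {PX.coeff (PX.neg p) i} { -K PX.coeff p i } (KX.coeff-neg p i)

  scale-as-⊗ : ∀ a X → PX.scale a X ≐ ((a ∷ []) ⊗X X)
  scale-as-⊗ a X = ≐-sym (≐-trans (KX.⊕-cong (≐-refl {PX.scale a X}) (KX.shift-[] [] ≐-refl)) (KX.⊕-identityʳ (PX.scale a X)))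

  shift-as-⊗ : ∀ X → PX.shift X ≐ (PX.var ⊗X X)
  shift-as-⊗ X = ≐-sym (KX.var-⊗ X)

  coeff-varPow-same : ∀ e → PX.coeff (PX.varPow e) e ≡ 1K
  coeff-varPow-same zero = refl
  coeff-varPow-same (suc e) = coeff-varPow-same e

  coeff-varPow-other : ∀ e i → e ≢ i → PX.coeff (PX.varPow e) i ≡ 0K
  coeff-varPow-other zero zero ne = ⊥-elim (ne refl)
  coeff-varPow-other zero (suc i) ne = refl
  coeff-varPow-other (suc e) zero ne = refl
  coeff-varPow-other (suc e) (suc i) ne = coeff-varPow-other e i (λ x → ne (cong suc x))

  coeff-monomial-same : ∀ a e → PX.coeff (PX.scale a (PX.varPow e)) e ≈k a
  coeff-monomial-same a e =
    KR.trans (coeff-scaleK a (PX.varPow e) e) (KR.trans (a *≈ ≡→≈ (coeff-varPow-same e)) (KR.*-identityʳ a))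

  coeff-monomial-other : ∀ a e i → e ≢ i → PX.coeff (PX.scale a (PX.varPow e)) i ≈k 0K
  coeff-monomial-other a e i ne =
    KR.trans (coeff-scaleK a (PX.varPow e) i) (KR.trans (a *≈ ≡→≈ (coeff-varPow-other e i ne)) (KR.zeroʳ a))

  sumTo-cong : ∀ B {F G : ℕ → KPoly} → (∀ j → j ≤ B → F j ≐ G j) → sumTo B F ≐ sumTo B G
  sumTo-cong zero h = h 0 z≤n
  sumTo-cong (suc B) h = KX.⊕-cong (sumTo-cong B (λ j le → h j (NP.m≤n⇒m≤1+n le))) (h (suc B) NP.≤-refl)

  sumTo-cong′ : ∀ B {F G : ℕ → KPoly} → (∀ j → F j ≐ G j) → sumTo B F ≐ sumTo B G
  sumTo-cong′ B h = sumTo-cong B (λ j _ → h j)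

  scale-sumTo : ∀ c B F → PX.scale c (sumTo B F) ≐ sumTo B (λ j → PX.scale c (F j))
  scale-sumTo c zero F = ≐-refl
  scale-sumTo c (suc B) F = ≐-trans (KX.scale-⊕ c (sumTo B F) (F (suc B))) (KX.⊕-cong (scale-sumTo c B F) ≐-refl)

  mul-sumTo : ∀ p B F → (p ⊗X sumTo B F) ≐ sumTo B (λ j → p ⊗X F j)
  mul-sumTo p zero F = ≐-refl
  mul-sumTo p (suc B) F = ≐-trans (KX.⊗-distribˡ p (sumTo B F) (F (suc B))) (KX.⊕-cong (mul-sumTo p B F) ≐-refl)

  sumTo-⊕ : ∀ B F G → (sumTo B F ⊕X sumTo B G) ≐ sumTo B (λ j → F j ⊕X G j)
  sumTo-⊕ zero F G = ≐-refl
  sumTo-⊕ (suc B) F G = ≐-trans (KX.⊕-interchange (sumTo B F) (F (suc B)) (sumTo B G) (G (suc B)))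
    (KX.⊕-cong (sumTo-⊕ B F G) ≐-refl)

  sumTo-first : ∀ B F → sumTo (suc B) F ≐ (F 0 ⊕X sumTo B (λ j → F (suc j)))
  sumTo-first zero F = ≐-refl
  sumTo-first (suc B) F = ≐-trans (KX.⊕-cong (sumTo-first B F) ≐-refl) (KX.⊕-assoc (F 0) _ _)

  coeff-sumTo-none : ∀ B (F : ℕ → KPoly) i → (∀ j → j ≤ B → PX.coeff (F j) i ≈k 0K) → PX.coeff (sumTo B F) i ≈k 0K
  coeff-sumTo-none zero F i h = h 0 z≤n
  coeff-sumTo-none (suc B) F i h = KR.trans (coeff-⊕K (sumTo B F) (F (suc B)) i)
    (KR.trans (KR.+-cong (coeff-sumTo-none B F i (λ j le → h j (NP.m≤n⇒m≤1+n le))) (h (suc B) NP.≤-refl)) (KR.+-identityʳ 0K))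

  coeff-sumTo-single : ∀ B (F : ℕ → KPoly) i j₀ → j₀ ≤ B → (∀ j → j ≤ B → j ≢ j₀ → PX.coeff (F j) i ≈k 0K) →
    PX.coeff (sumTo B F) i ≈k PX.coeff (F j₀) i
  coeff-sumTo-single zero F i zero le h = ≈k-refl
  coeff-sumTo-single (suc B) F i j₀ le h with j₀ ≟ suc B
  ... | yes refl = KR.trans (coeff-⊕K (sumTo B F) (F (suc B)) i)
        (KR.trans (KR.+-cong (coeff-sumTo-none B F i (λ j le' → h j (NP.m≤n⇒m≤1+n le') (λ e → NP.<⇒≢ (s≤s le') e)))
                             (≈k-refl {PX.coeff (F j₀) i}))
                  (KR.+-identityˡ _))
  ... | no ne = KR.trans (coeff-⊕K (sumTo B F) (F (suc B)) i)
        (KR.trans (KR.+-cong (coeff-sumTo-single B F i j₀ j₀≤B (λ j le'' → h j (NP.m≤n⇒m≤1+n le'')))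
                             (h (suc B) NP.≤-refl (λ e → ne (sym e))))
                  (KR.+-identityʳ _))
    where
    j₀≤B : j₀ ≤ B
    j₀≤B = NP.≤-pred (NP.≤∧≢⇒< le ne)

module ClosedForm where

  open KAlgebra
  open QNumbers
  open IndexArithmetic
  open CoefficientRecurrence
  open KPolynomials
  open import Data.Nat using (ℕ; _+_; _*_; _∸_; _≤_; ⌊_/2⌋)
  import Data.Nat.Properties as NP
  open import Data.List using ([]; _∷_; _++_)
  open import Relation.Binary.PropositionalEquality using (_≡_; _≢_; cong; sym; trans; subst)
  open KX using (_≐_; ≐-refl; ≐-trans)
  open KReason

  ratio-split : ∀ n j i → divK (embed (onePlusQ (n ∸ j ∸ i))) (onePlusQNZ (j + 1 + i))
                          ≈k (qplus (n ∸ j ∸ i) *K qplus⁻¹ (j + 1 + i))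
  ratio-split n j i = frac-split (onePlusQ (n ∸ j ∸ i)) (onePlusQNZ (j + 1 + i) ∷ [])

  -- for n = m + 2j + k the product over i < k telescopes:
  --   ∏ (1+q^(n-j-i)) / (1+q^(j+1+i)) = P(m+j+k)/P(m+j) · P(j)/P(j+k)
  gCoef-product : ∀ m j k →
    prodK k (λ i → divK (embed (onePlusQ (m + 2 * j + k ∸ j ∸ i))) (onePlusQNZ (j + 1 + i)))
    ≈k ((plusFac (m + j + k) *K plusFac⁻¹ (m + j)) *K (plusFac j *K plusFac⁻¹ (j + k)))
  gCoef-product m j k = begin
    prodK k (λ i → divK (embed (onePlusQ (m + 2 * j + k ∸ j ∸ i))) (onePlusQNZ (j + 1 + i)))
      ≈⟨ prodK-cong k (λ i → KR.trans (ratio-split (m + 2 * j + k) j i)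
                                      (≡→≈ (cong (λ z → qplus (z ∸ i)) (N∸j m j k)) ≈* qplus⁻¹ (j + 1 + i))) ⟩
    prodK k (λ i → qplus ((m + j) + k ∸ i) *K qplus⁻¹ (j + 1 + i))
      ≈⟨ prodK-mul k (λ i → qplus ((m + j) + k ∸ i)) (λ i → qplus⁻¹ (j + 1 + i)) ⟩
    prodK k (λ i → qplus ((m + j) + k ∸ i)) *K prodK k (λ i → qplus⁻¹ (j + 1 + i))
      ≈⟨ KR.*-cong (prod-qplus k (m + j)) (prod-qplus⁻¹ k j) ⟩
    (plusFac (m + j + k) *K plusFac⁻¹ (m + j)) *K (plusFac j *K plusFac⁻¹ (j + k)) ∎

  gCoef-closed : ∀ m j k → (qbinK (m + 2 * j + k) k *K gCoef (m + 2 * j + k) k j) ≈k coef m j k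
  gCoef-closed m j k = begin
    qbinK n k *K (spow j *K qpow (qExp j k) *K qbinK (n ∸ k) (2 * j) *K oddFacK j
                  *K prodK k (λ i → divK (embed (onePlusQ (n ∸ j ∸ i))) (onePlusQNZ (j + 1 + i))))
      ≈⟨ KR.*-cong (KR.trans (qbin-qfac n k) ((qfacK n *K qfacK⁻¹ k) *≈ ≡→≈ (cong qfacK⁻¹ (N∸k m j k))))
           (KR.*-cong ((spow j *K qpow (qExp j k) *≈ KR.trans (qbin-qfac (n ∸ k) (2 * j))
                         (KR.*-cong (≡→≈ (cong qfacK (N∸k m j k)) ≈* qfacK⁻¹ (2 * j))
                                    (≡→≈ (trans (cong (λ z → qfacK⁻¹ (z ∸ 2 * j)) (N∸k m j k)) (cong qfacK⁻¹ (NP.m+n∸n≡m m (2 * j)))))))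
                       ≈* oddFacK j)
                      (gCoef-product m j k)) ⟩
    (fn *K ifk *K ifm2) *K (spow j *K qpow (qExp j k) *K (fm2 *K if2 *K qfacK⁻¹ m) *K oddFacK j *K ((p1 *K ip1) *K (plusFac j *K ipjk)))
      ≈⟨ drop-unit (SK.solve 13 (λ fn ifk ifm2 sp qe fm2 if2 ifm o p1 ip1 pj ipjk →
            (fn SK.:* ifk SK.:* ifm2) SK.:* (sp SK.:* qe SK.:* (fm2 SK.:* if2 SK.:* ifm) SK.:* o SK.:* ((p1 SK.:* ip1) SK.:* (pj SK.:* ipjk)))
            SK.:= (fn SK.:* ifk SK.:* sp SK.:* qe SK.:* (if2 SK.:* o) SK.:* ifm SK.:* p1 SK.:* ip1 SK.:* pj SK.:* ipjk) SK.:* (ifm2 SK.:* fm2))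
            ≈k-refl fn ifk ifm2 (spow j) (qpow (qExp j k)) fm2 if2 (qfacK⁻¹ m) (oddFacK j) p1 ip1 (plusFac j) ipjk)
            (qfacK⁻¹-l (m + 2 * j)) ⟩
    fn *K ifk *K spow j *K qpow (qExp j k) *K (if2 *K oddFacK j) *K qfacK⁻¹ m *K p1 *K ip1 *K plusFac j *K ipjk
      ≈⟨ (((((fn *K ifk *K spow j *K qpow (qExp j k)) *≈ qfacK⁻¹-double j) ≈* qfacK⁻¹ m ≈* p1) ≈* ip1 ≈* plusFac j) ≈* ipjk) ⟩
    fn *K ifk *K spow j *K qpow (qExp j k) *K (plusFac⁻¹ j *K qfacK⁻¹ j) *K qfacK⁻¹ m *K p1 *K ip1 *K plusFac j *K ipjk
      ≈⟨ drop-unit (SK.solve 11 (λ fn ifk sp qe ipj ifj ifm p1 ip1 pj ipjk →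
            fn SK.:* ifk SK.:* sp SK.:* qe SK.:* (ipj SK.:* ifj) SK.:* ifm SK.:* p1 SK.:* ip1 SK.:* pj SK.:* ipjk
            SK.:= (sp SK.:* qe SK.:* fn SK.:* p1 SK.:* ifk SK.:* ifm SK.:* ifj SK.:* ip1 SK.:* ipjk) SK.:* (ipj SK.:* pj))
            ≈k-refl fn ifk (spow j) (qpow (qExp j k)) (plusFac⁻¹ j) (qfacK⁻¹ j) (qfacK⁻¹ m) p1 ip1 (plusFac j) ipjk)
            (plusFac⁻¹-l j) ⟩
    coef m j k ∎
    where
    n = m + 2 * j + k
    fn = qfacK n
    ifk = qfacK⁻¹ k
    ifm2 = qfacK⁻¹ (m + 2 * j)
    fm2 = qfacK (m + 2 * j)
    if2 = qfacK⁻¹ (2 * j)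
    p1 = plusFac (m + j + k)
    ip1 = plusFac⁻¹ (m + j)
    ipjk = plusFac⁻¹ (j + k)

  gTerm : ℕ → ℕ → ℕ → KPoly
  gTerm n k j = PX.scale (gCoef n k j) (PX.varPow (n ∸ k ∸ 2 * j))

  -- the x^m-coefficient of g_n(k) at a shape (m, j, k) of n: only the j-th term contributes
  coeff-gPoly-on : ∀ m j k → PX.coeff (gPoly (m + 2 * j + k) k) m ≈k coef m j k
  coeff-gPoly-on m j k = begin
    PX.coeff (gPoly n k) m                         ≈⟨ coeff-scaleK (qbinK n k) (sumTo B (gTerm n k)) m ⟩
    qbinK n k *K PX.coeff (sumTo B (gTerm n k)) m  ≈⟨ qbinK n k *≈ coeff-sumTo-single B (gTerm n k) m j j≤B others-vanish ⟩
    qbinK n k *K PX.coeff (gTerm n k j) m          ≈⟨ qbinK n k *≈ term-j ⟩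
    qbinK n k *K gCoef n k j                       ≈⟨ gCoef-closed m j k ⟩
    coef m j k                                     ∎
    where
    n = m + 2 * j + k
    B = ⌊ (n ∸ k) /2⌋
    j≤B : j ≤ B
    j≤B = subst (λ z → j ≤ ⌊ z /2⌋) (sym (N∸k m j k)) (half-ge m j)
    term-j : PX.coeff (gTerm n k j) m ≈k gCoef n k j
    term-j = subst (λ z → PX.coeff (PX.scale (gCoef n k j) (PX.varPow z)) m ≈k gCoef n k j)
                   (sym (trans (cong (_∸ 2 * j) (N∸k m j k)) (NP.m+n∸n≡m m (2 * j)))) (coeff-monomial-same (gCoef n k j) m)
    others-vanish : ∀ j' → j' ≤ B → j' ≢ j → PX.coeff (gTerm n k j') m ≈k 0K
    others-vanish j' le ne = coeff-monomial-other (gCoef n k j') (n ∸ k ∸ 2 * j') m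
      (λ e → ne (index-unique m j j' (subst (2 * j' ≤_) (N∸k m j k) (half-le (n ∸ k) j' le))
                                     (trans (cong (_∸ 2 * j') (sym (N∸k m j k))) e)))

  coeff-gPoly-off : ∀ n k m → k ≤ n → (∀ j → n ≢ m + 2 * j + k) → PX.coeff (gPoly n k) m ≈k 0K
  coeff-gPoly-off n k m k≤n not-shape = KR.trans (coeff-scaleK (qbinK n k) (sumTo B (gTerm n k)) m)
    (KR.trans (qbinK n k *≈ coeff-sumTo-none B (gTerm n k) m
       (λ j le → coeff-monomial-other (gCoef n k j) (n ∸ k ∸ 2 * j) m
                   (λ e → not-shape j (shape-of-index n k m j k≤n (half-le (n ∸ k) j le) e))))
     (KR.zeroʳ (qbinK n k)))
    where
    B = ⌊ (n ∸ k) /2⌋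

  hCoef : ℕ → ℕ → K
  hCoef n j = powK qK (j * j) *K powK sK j *K (qfact n / (onePlusQNZs j ++ qfactNZs j ++ qfactNZs (n ∸ 2 * j)))

  hFraction : ∀ m j → (qfact (m + 2 * j + 0) / (onePlusQNZs j ++ qfactNZs j ++ qfactNZs (m + 2 * j + 0 ∸ 2 * j)))
                      ≈k (qfacK (m + 2 * j + 0) *K (plusFac⁻¹ j *K (qfacK⁻¹ j *K qfacK⁻¹ m)))
  hFraction m j = begin
    qfact n / (onePlusQNZs j ++ qfactNZs j ++ qfactNZs (n ∸ 2 * j))
      ≈⟨ frac-split (qfact n) _ ⟩
    embed (qfact n) *K invList (onePlusQNZs j ++ qfactNZs j ++ qfactNZs (n ∸ 2 * j))
      ≈⟨ KR.*-cong (KR.sym (qfacK-embed n))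
                   (KR.trans (invList-++ (onePlusQNZs j) _) (invList (onePlusQNZs j) *≈ invList-++ (qfactNZs j) (qfactNZs (n ∸ 2 * j)))) ⟩
    qfacK n *K (invList (onePlusQNZs j) *K (invList (qfactNZs j) *K invList (qfactNZs (n ∸ 2 * j))))
      ≈⟨ qfacK n *≈ KR.*-cong (KR.sym (plusFac⁻¹-invList j))
                              (KR.*-cong (KR.sym (qfacK⁻¹-invList j))
                                         (KR.trans (KR.sym (qfacK⁻¹-invList (n ∸ 2 * j))) (≡→≈ (cong qfacK⁻¹ (N∸double m j))))) ⟩
    qfacK n *K (plusFac⁻¹ j *K (qfacK⁻¹ j *K qfacK⁻¹ m)) ∎
    where
    n = m + 2 * j + 0

  hCoef-closed : ∀ m j → (qbinK (m + 2 * j + 0) 0 *K gCoef (m + 2 * j + 0) 0 j) ≈k hCoef (m + 2 * j + 0) j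
  hCoef-closed m j = begin
    qbinK n 0 *K gCoef n 0 j
      ≈⟨ gCoef-closed m j 0 ⟩
    coef m j 0
      ≈⟨ *-cong₉ (≈refl (spow j)) (≡→≈ (cong qpow (qExp-k0 j))) (≈refl (qfacK n)) (≡→≈ (cong plusFac (NP.+-identityʳ (m + j))))
                 (≈refl 1K) (≈refl (qfacK⁻¹ m)) (≈refl (qfacK⁻¹ j)) (≈refl (plusFac⁻¹ (m + j))) (≡→≈ (cong plusFac⁻¹ (NP.+-identityʳ j))) ⟩
    spow j *K qpow (j * j) *K qfacK n *K plusFac (m + j) *K 1K *K qfacK⁻¹ m *K qfacK⁻¹ j *K plusFac⁻¹ (m + j) *K plusFac⁻¹ j
      ≈⟨ drop-unit (SK.solve 8 (λ sp qj fn p ifm ifj ip ipj → sp SK.:* qj SK.:* fn SK.:* p SK.:* one SK.:* ifm SK.:* ifj SK.:* ip SK.:* ipj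
            SK.:= (qj SK.:* sp SK.:* (fn SK.:* (ipj SK.:* (ifj SK.:* ifm)))) SK.:* (ip SK.:* p))
            ≈k-refl (spow j) (qpow (j * j)) (qfacK n) (plusFac (m + j)) (qfacK⁻¹ m) (qfacK⁻¹ j) (plusFac⁻¹ (m + j)) (plusFac⁻¹ j))
          (plusFac⁻¹-l (m + j)) ⟩
    qpow (j * j) *K spow j *K (qfacK n *K (plusFac⁻¹ j *K (qfacK⁻¹ j *K qfacK⁻¹ m)))
      ≈⟨ qpow (j * j) *K spow j *≈ KR.sym (hFraction m j) ⟩
    hCoef n j ∎
    where
    n = m + 2 * j + 0

  gPoly0≐hPoly : ∀ n → gPoly n 0 ≐ hPoly n
  gPoly0≐hPoly n = ≐-trans (scale-sumTo (qbinK n 0) B (gTerm n 0))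
    (sumTo-cong B (λ j le → ≐-trans (KX.scale-scale (qbinK n 0) (gCoef n 0 j) _)
       (KX.scale-cong (toK (same-coefficient j le)) ≐-refl)))
    where
    B = ⌊ n /2⌋
    same-coefficient : ∀ j → j ≤ B → (qbinK n 0 *K gCoef n 0 j) ≈k hCoef n j
    same-coefficient j le = subst (λ z → (qbinK z 0 *K gCoef z 0 j) ≈k hCoef z j) (sym n-shape) (hCoef-closed (n ∸ 2 * j) j)
      where
      n-shape : n ≡ n ∸ 2 * j + 2 * j + 0
      n-shape = sym (trans (NP.+-identityʳ _) (NP.m∸n+n≡m (half-le n j le)))

-- The q-derivative on coefficients: D_q multiplies the coefficient of x^(i+1)
-- by [i+1] and moves it to x^i; hence D_q is additive and K-linear, and it
-- obeys the q-Leibniz rule D_q(g h) = D_q g · h + g(qx) · D_q h.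
module QDerivative where

  open KAlgebra
  open QNumbers
  open KPolynomials
  open import Data.Nat using (zero; suc; _+_)
  import Data.Nat.Properties as NP
  open import Data.List using ([]; _∷_)
  open import Relation.Binary.PropositionalEquality using (_≡_; refl; cong; sym)
  open KX using (_≐_; ≐-refl; ≐-sym; ≐-trans) renaming (_⊕_ to _⊕X_; _⊗_ to _⊗X_)
  open SX using (_⊜_) renaming (_⊕_ to _:+_; _⊗_ to _:*_)
  open KR using () renaming (_-_ to _-K_)
  open KReason

  constX : K → KPoly
  constX a = a ∷ []

  coeff-divX : ∀ p i → PX.coeff (divX p) i ≡ PX.coeff p (suc i)
  coeff-divX [] i = refl
  coeff-divX (x ∷ p) i = refl

  coeff-argScaleFrom : ∀ c m f i → PX.coeff (argScaleFrom c m f) i ≈k (PX.coeff f i *K powK c (m + i))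
  coeff-argScaleFrom c m [] i = KR.sym (KR.zeroˡ (powK c (m + i)))
  coeff-argScaleFrom c m (a ∷ f) zero = a *≈ ≡→≈ (cong (powK c) (sym (NP.+-identityʳ m)))
  coeff-argScaleFrom c m (a ∷ f) (suc i) =
    KR.trans (coeff-argScaleFrom c (suc m) f i) (PX.coeff f i *≈ ≡→≈ (cong (powK c) (sym (NP.+-suc m i))))

  coeff-argScale : ∀ f i → PX.coeff (argScale qK f) i ≈k (qpow i *K PX.coeff f i)
  coeff-argScale f i = KR.trans (coeff-argScaleFrom qK 0 f i) (KR.*-comm (PX.coeff f i) (qpow i))

  -- (f(qx) - f(x)) / ((q-1)x) has coefficients (q^(i+1) - 1)/(q-1) · a_(i+1) = [i+1] a_(i+1)
  Dq-coeff : ∀ f i → PX.coeff (Dq f) i ≈k (qint (suc i) *K PX.coeff f (suc i))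
  Dq-coeff f i = begin
    PX.coeff (Dq f) i
      ≈⟨ coeff-scaleK qMinus1⁻¹ (divX (argScale qK f ⊕X PX.neg f)) i ⟩
    qMinus1⁻¹ *K PX.coeff (divX (argScale qK f ⊕X PX.neg f)) i
      ≈⟨ qMinus1⁻¹ *≈ ≡→≈ (coeff-divX (argScale qK f ⊕X PX.neg f) i) ⟩
    qMinus1⁻¹ *K PX.coeff (argScale qK f ⊕X PX.neg f) (suc i)
      ≈⟨ qMinus1⁻¹ *≈ KR.trans (coeff-⊕K (argScale qK f) (PX.neg f) (suc i)) (KR.+-cong (coeff-argScale f (suc i)) (coeff-negK f (suc i))) ⟩
    qMinus1⁻¹ *K (qpow (suc i) *K x +K (-K x))
      ≈⟨ SK.solve 3 (λ i q x → i SK.:* (q SK.:* x SK.:+ (SK.:- x)) SK.:= x SK.:* (q SK.:- one) SK.:* i) ≈k-refl qMinus1⁻¹ (qpow (suc i)) x ⟩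
    x *K (qpow (suc i) -K 1K) *K qMinus1⁻¹
      ≈⟨ (x *≈ KR.sym (qint-qMinus1 (suc i))) ≈* qMinus1⁻¹ ⟩
    x *K (qint (suc i) *K qMinus1) *K qMinus1⁻¹
      ≈⟨ drop-unit (SK.solve 4 (λ x e d i → x SK.:* (e SK.:* d) SK.:* i SK.:= (e SK.:* x) SK.:* (i SK.:* d)) ≈k-refl x (qint (suc i)) qMinus1 qMinus1⁻¹)
                   qMinus1⁻¹-l ⟩
    qint (suc i) *K x ∎
    where
    x = PX.coeff f (suc i)

  Dq-cong : ∀ {f g} → f ≐ g → Dq f ≐ Dq g
  Dq-cong {f} {g} h = coeffEq λ i →
    KR.trans (Dq-coeff f i) (KR.trans (qint (suc i) *≈ coeffOf h (suc i)) (KR.sym (Dq-coeff g i)))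

  Dq-⊕ : ∀ f g → Dq (f ⊕X g) ≐ (Dq f ⊕X Dq g)
  Dq-⊕ f g = coeffEq λ i → begin
    PX.coeff (Dq (f ⊕X g)) i                                    ≈⟨ Dq-coeff (f ⊕X g) i ⟩
    qint (suc i) *K PX.coeff (f ⊕X g) (suc i)                   ≈⟨ qint (suc i) *≈ coeff-⊕K f g (suc i) ⟩
    qint (suc i) *K (PX.coeff f (suc i) +K PX.coeff g (suc i))  ≈⟨ KR.distribˡ (qint (suc i)) (PX.coeff f (suc i)) (PX.coeff g (suc i)) ⟩
    qint (suc i) *K PX.coeff f (suc i) +K qint (suc i) *K PX.coeff g (suc i)
                                                                ≈⟨ KR.sym (KR.+-cong (Dq-coeff f i) (Dq-coeff g i)) ⟩
    PX.coeff (Dq f) i +K PX.coeff (Dq g) i                      ≈⟨ KR.sym (coeff-⊕K (Dq f) (Dq g) i) ⟩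
    PX.coeff (Dq f ⊕X Dq g) i                                   ∎

  Dq-scale : ∀ c f → Dq (PX.scale c f) ≐ PX.scale c (Dq f)
  Dq-scale c f = coeffEq λ i → begin
    PX.coeff (Dq (PX.scale c f)) i                   ≈⟨ Dq-coeff (PX.scale c f) i ⟩
    qint (suc i) *K PX.coeff (PX.scale c f) (suc i)  ≈⟨ qint (suc i) *≈ coeff-scaleK c f (suc i) ⟩
    qint (suc i) *K (c *K PX.coeff f (suc i))
      ≈⟨ SK.solve 3 (λ e c x → e SK.:* (c SK.:* x) SK.:= c SK.:* (e SK.:* x)) ≈k-refl (qint (suc i)) c (PX.coeff f (suc i)) ⟩
    c *K (qint (suc i) *K PX.coeff f (suc i))        ≈⟨ c *≈ KR.sym (Dq-coeff f i) ⟩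
    c *K PX.coeff (Dq f) i                           ≈⟨ KR.sym (coeff-scaleK c (Dq f) i) ⟩
    PX.coeff (PX.scale c (Dq f)) i                   ∎

  Dq-sumTo : ∀ B F → Dq (sumTo B F) ≐ sumTo B (λ j → Dq (F j))
  Dq-sumTo zero F = ≐-refl
  Dq-sumTo (suc B) F = ≐-trans (Dq-⊕ (sumTo B F) (F (suc B))) (KX.⊕-cong (Dq-sumTo B F) ≐-refl)

  scale-shift-as-⊗ : ∀ c p → PX.scale c (PX.shift p) ≐ (constX c ⊗X (PX.var ⊗X p))
  scale-shift-as-⊗ c p = ≐-trans (scale-as-⊗ c (PX.shift p)) (KX.⊗-congʳ (constX c) (shift-as-⊗ p))

  -- D_q(a + x g) = g + q x D_q g, coefficientwise [i+1] = 1 + q[i]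
  Dq-cons : ∀ a g → Dq (a ∷ g) ≐ (g ⊕X (constX qK ⊗X (PX.var ⊗X Dq g)))
  Dq-cons a g = ≐-trans (coeffEq λ i → KR.trans (Dq-coeff (a ∷ g) i) (KR.trans (step i) (KR.sym
                  (KR.trans (coeff-⊕K g (PX.scale qK (PX.shift (Dq g))) i) (PX.coeff g i +≈ coeff-scaleK qK (PX.shift (Dq g)) i)))))
                (KX.⊕-cong (≐-refl {g}) (scale-shift-as-⊗ qK (Dq g)))
    where
    step : ∀ i → (qint (suc i) *K PX.coeff g i) ≈k (PX.coeff g i +K qK *K PX.coeff (PX.shift (Dq g)) i)
    step zero = begin
      qint 1 *K PX.coeff g 0
        ≈⟨ KR.trans (qint-suc 0) (KR.trans (1K +≈ KR.zeroʳ qK) (KR.+-identityʳ 1K)) ≈* PX.coeff g 0 ⟩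
      1K *K PX.coeff g 0
        ≈⟨ KR.*-identityˡ (PX.coeff g 0) ⟩
      PX.coeff g 0
        ≈⟨ KR.sym (KR.trans (PX.coeff g 0 +≈ KR.zeroʳ qK) (KR.+-identityʳ (PX.coeff g 0))) ⟩
      PX.coeff g 0 +K qK *K 0K ∎
    step (suc i) = begin
      qint (suc (suc i)) *K PX.coeff g (suc i)
        ≈⟨ qint-suc (suc i) ≈* PX.coeff g (suc i) ⟩
      (1K +K qK *K qint (suc i)) *K PX.coeff g (suc i)
        ≈⟨ SK.solve 3 (λ q e x → (one SK.:+ q SK.:* e) SK.:* x SK.:= x SK.:+ q SK.:* (e SK.:* x)) ≈k-refl qK (qint (suc i)) (PX.coeff g (suc i)) ⟩
      PX.coeff g (suc i) +K qK *K (qint (suc i) *K PX.coeff g (suc i))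
        ≈⟨ PX.coeff g (suc i) +≈ (qK *≈ KR.sym (Dq-coeff g i)) ⟩
      PX.coeff g (suc i) +K qK *K PX.coeff (Dq g) i ∎

  argScale-cons : ∀ a g → argScale qK (a ∷ g) ≐ (constX a ⊕X (constX qK ⊗X (PX.var ⊗X argScale qK g)))
  argScale-cons a g = ≐-trans (coeffEq λ i → KR.trans (coeff-argScale (a ∷ g) i)
                        (KR.sym (KR.trans (coeff-⊕K (constX a) (PX.scale qK (PX.shift (argScale qK g))) i) (step i))))
                      (KX.⊕-cong (≐-refl {constX a}) (scale-shift-as-⊗ qK (argScale qK g)))
    where
    step : ∀ i → (PX.coeff (constX a) i +K PX.coeff (PX.scale qK (PX.shift (argScale qK g))) i) ≈k (qpow i *K PX.coeff (a ∷ g) i)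
    step zero = KR.trans (a +≈ KR.trans (coeff-scaleK qK (PX.shift (argScale qK g)) 0) (KR.zeroʳ qK))
                         (KR.trans (KR.+-identityʳ a) (KR.sym (KR.*-identityˡ a)))
    step (suc i) = begin
      0K +K PX.coeff (PX.scale qK (PX.shift (argScale qK g))) (suc i)  ≈⟨ KR.+-identityˡ _ ⟩
      PX.coeff (PX.scale qK (PX.shift (argScale qK g))) (suc i)        ≈⟨ coeff-scaleK qK (PX.shift (argScale qK g)) (suc i) ⟩
      qK *K PX.coeff (argScale qK g) i                                 ≈⟨ qK *≈ coeff-argScale g i ⟩
      qK *K (qpow i *K PX.coeff g i)
        ≈⟨ SK.solve 3 (λ q a b → q SK.:* (a SK.:* b) SK.:= (a SK.:* q) SK.:* b) ≈k-refl qK (qpow i) (PX.coeff g i) ⟩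
      qpow (suc i) *K PX.coeff g i ∎

  Dq-Leibniz : ∀ g h → Dq (g ⊗X h) ≐ ((Dq g ⊗X h) ⊕X (argScale qK g ⊗X Dq h))
  Dq-Leibniz [] h = ≐-refl
  Dq-Leibniz (a ∷ g) h = XR.begin
    Dq (PX.scale a h ⊕X PX.shift (g ⊗X h))
      XR.≈⟨ ≐-trans (Dq-⊕ (PX.scale a h) (PX.shift (g ⊗X h)))
                    (KX.⊕-cong (≐-trans (Dq-scale a h) (scale-as-⊗ a (Dq h))) (Dq-cons 0K (g ⊗X h))) ⟩
    (A ⊗X Dq h) ⊕X ((g ⊗X h) ⊕X (Qc ⊗X (PX.var ⊗X Dq (g ⊗X h))))
      XR.≈⟨ KX.⊕-cong (≐-refl {A ⊗X Dq h}) (KX.⊕-cong (≐-refl {g ⊗X h}) (KX.⊗-congʳ Qc (KX.⊗-congʳ PX.var (Dq-Leibniz g h)))) ⟩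
    (A ⊗X Dq h) ⊕X ((g ⊗X h) ⊕X (Qc ⊗X (PX.var ⊗X ((Dq g ⊗X h) ⊕X (argScale qK g ⊗X Dq h)))))
      XR.≈⟨ SX.solve 8 (λ A G H Qc V DG SG DH →
              (A :* DH) :+ ((G :* H) :+ (Qc :* (V :* ((DG :* H) :+ (SG :* DH)))))
              ⊜ (((G :+ (Qc :* (V :* DG))) :* H) :+ ((A :+ (Qc :* (V :* SG))) :* DH))) ≐-refl
              A g h Qc PX.var (Dq g) (argScale qK g) (Dq h) ⟩
    ((g ⊕X (Qc ⊗X (PX.var ⊗X Dq g))) ⊗X h) ⊕X ((A ⊕X (Qc ⊗X (PX.var ⊗X argScale qK g))) ⊗X Dq h)
      XR.≈⟨ ≐-sym (KX.⊕-cong (KX.⊗-congˡ h (Dq-cons a g)) (KX.⊗-congˡ (Dq h) (argScale-cons a g))) ⟩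
    (Dq (a ∷ g) ⊗X h) ⊕X (argScale qK (a ∷ g) ⊗X Dq h) XR.∎
    where
    A = constX a
    Qc = constX qK

-- Compare x^m-coefficients: at a shape of n+1 they are the three terms of
-- coef-recurrence, elsewhere all of them vanish.
module GRecurrence where

  open KAlgebra
  open QNumbers
  open IndexArithmetic
  open CoefficientRecurrence
  open KPolynomials
  open ClosedForm
  open QDerivative
  open import Data.Nat using (ℕ; zero; suc; _+_; _*_; _≤_; z≤n)
  import Data.Nat.Properties as NP
  open import Data.Sum using (inj₁; inj₂)
  open import Relation.Binary.PropositionalEquality using (_≡_; _≢_; refl; cong; sym; subst)
  open KX using (_≐_) renaming (_⊕_ to _⊕X_; _⊗_ to _⊗X_)
  open KReason

  gc : ℕ → ℕ → ℕ → K
  gc n k m = PX.coeff (gPoly n k) m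

  gc-on : ∀ n k m j → n ≡ m + 2 * j + k → gc n k m ≈k coef m j k
  gc-on n k m j e = subst (λ z → gc z k m ≈k coef m j k) (sym e) (coeff-gPoly-on m j k)

  -- the two parts of g_{n+1}(k) coming from X + q^n s D_q applied to the k-th and
  -- the (k-1)-th term of the right-hand side
  gXD : ℕ → ℕ → KPoly
  gXD n k = (PX.var ⊗X gPoly n k) ⊕X PX.scale (powK qK n *K sK) (Dq (gPoly n k))

  gQ : ℕ → ℕ → KPoly
  gQ n k = PX.scale (powK qK n) (argScale qK (gPoly n k))

  contribX : ℕ → ℕ → ℕ → K
  contribX n k zero = 0K
  contribX n k (suc m) = gc n k m

  contribD : ℕ → ℕ → ℕ → K
  contribD n k m = qpow n *K sK *K qint (suc m) *K gc n k (suc m)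

  contribS : ℕ → ℕ → ℕ → K
  contribS n zero m = 0K
  contribS n (suc k) m = qpow n *K qpow m *K gc n k m

  coeff-gXD : ∀ n k m → PX.coeff (gXD n k) m ≈k (contribX n k m +K contribD n k m)
  coeff-gXD n k m = begin
    PX.coeff (gXD n k) m
      ≈⟨ coeff-⊕K (PX.var ⊗X gPoly n k) (PX.scale (powK qK n *K sK) (Dq (gPoly n k))) m ⟩
    PX.coeff (PX.var ⊗X gPoly n k) m +K PX.coeff (PX.scale (powK qK n *K sK) (Dq (gPoly n k))) m
      ≈⟨ KR.+-cong (KR.trans (coeffOf (KX.var-⊗ (gPoly n k)) m) (shifted m))
                   (KR.trans (coeff-scaleK (qpow n *K sK) (Dq (gPoly n k)) m) ((qpow n *K sK) *≈ Dq-coeff (gPoly n k) m)) ⟩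
    contribX n k m +K (qpow n *K sK) *K (qint (suc m) *K gc n k (suc m))
      ≈⟨ contribX n k m +≈ SK.solve 4 (λ a b c d → (a SK.:* b) SK.:* (c SK.:* d) SK.:= a SK.:* b SK.:* c SK.:* d)
                                       ≈k-refl (qpow n) sK (qint (suc m)) (gc n k (suc m)) ⟩
    contribX n k m +K contribD n k m ∎
    where
    shifted : ∀ m → PX.coeff (PX.shift (gPoly n k)) m ≈k contribX n k m
    shifted zero = ≈k-refl
    shifted (suc m) = ≈k-refl

  coeff-gQ : ∀ n k m → PX.coeff (gQ n k) m ≈k contribS n (suc k) m
  coeff-gQ n k m = begin
    PX.coeff (gQ n k) m                             ≈⟨ coeff-scaleK (qpow n) (argScale qK (gPoly n k)) m ⟩
    qpow n *K PX.coeff (argScale qK (gPoly n k)) m  ≈⟨ qpow n *≈ coeff-argScale (gPoly n k) m ⟩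
    qpow n *K (qpow m *K gc n k m)                  ≈⟨ KR.sym (KR.*-assoc (qpow n) (qpow m) (gc n k m)) ⟩
    qpow n *K qpow m *K gc n k m                    ∎

  contribX-on : ∀ n k m j → suc n ≡ m + 2 * j + k → contribX n k m ≈k termX m j k
  contribX-on n k zero j e = ≈k-refl
  contribX-on n k (suc m) j e = gc-on n k m j (NP.suc-injective e)

  contribD-on : ∀ n k m j → k ≤ n → suc n ≡ m + 2 * j + k → contribD n k m ≈k termD n m j k
  contribD-on n k m zero k≤n e =
    KR.trans (qpow n *K sK *K qint (suc m) *≈ coeff-gPoly-off n k (suc m) k≤n (λ j' e' → shape-j0-clash n m j' k e e'))
             (KR.zeroʳ (qpow n *K sK *K qint (suc m)))
  contribD-on n k m (suc j) k≤n e = qpow n *K sK *K qint (suc m) *≈ gc-on n k (suc m) j (shape-j⁻ n m j k e)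

  contribS-on : ∀ n k m j → suc n ≡ m + 2 * j + k → contribS n k m ≈k termS n m j k
  contribS-on n zero m j e = ≈k-refl
  contribS-on n (suc k) m j e = qpow n *K qpow m *≈ gc-on n k m j (shape-k⁻ n m j k e)

  contribX-off : ∀ n k m → k ≤ n → (∀ j → suc n ≢ m + 2 * j + k) → contribX n k m ≈k 0K
  contribX-off n k zero k≤n h = ≈k-refl
  contribX-off n k (suc m) k≤n h = coeff-gPoly-off n k m k≤n (λ j e → h j (cong suc e))

  contribD-off : ∀ n k m → k ≤ n → (∀ j → suc n ≢ m + 2 * j + k) → contribD n k m ≈k 0K
  contribD-off n k m k≤n h =
    KR.trans (qpow n *K sK *K qint (suc m) *≈ coeff-gPoly-off n k (suc m) k≤n (λ j e → h (suc j) (shape-j⁺ n m j k e)))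
             (KR.zeroʳ (qpow n *K sK *K qint (suc m)))

  contribS-off : ∀ n k m → k ≤ n → (∀ j → suc n ≢ m + 2 * j + k) → contribS n k m ≈k 0K
  contribS-off n zero m k≤n h = ≈k-refl
  contribS-off n (suc k) m k≤n h =
    KR.trans (qpow n *K qpow m *≈ coeff-gPoly-off n k m (NP.≤-trans (NP.n≤1+n k) k≤n) (λ j e → h j (shape-k⁺ n m j k e)))
             (KR.zeroʳ (qpow n *K qpow m))

  coeff-gPoly-suc : ∀ n k m → k ≤ n → gc (suc n) k m ≈k (contribX n k m +K contribD n k m +K contribS n k m)
  coeff-gPoly-suc n k m k≤n with decide-shape (suc n) k m
  ... | inj₁ (j , e) = begin
    gc (suc n) k m                                  ≈⟨ gc-on (suc n) k m j e ⟩
    coef m j k                                      ≈⟨ coef-recurrence n m j k e ⟩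
    termX m j k +K termD n m j k +K termS n m j k
      ≈⟨ KR.sym (KR.+-cong (KR.+-cong (contribX-on n k m j e) (contribD-on n k m j k≤n e)) (contribS-on n k m j e)) ⟩
    contribX n k m +K contribD n k m +K contribS n k m ∎
  ... | inj₂ not-shape = begin
    gc (suc n) k m  ≈⟨ coeff-gPoly-off (suc n) k m (NP.m≤n⇒m≤1+n k≤n) not-shape ⟩
    0K              ≈⟨ KR.sym (KR.trans (KR.+-cong (KR.+-cong (contribX-off n k m k≤n not-shape) (contribD-off n k m k≤n not-shape))
                                                   (contribS-off n k m k≤n not-shape))
                                        (KR.trans (KR.+-identityʳ (0K +K 0K)) (KR.+-identityʳ 0K))) ⟩
    contribX n k m +K contribD n k m +K contribS n k m ∎

  g-rec-first : ∀ n → gPoly (suc n) 0 ≐ gXD n 0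
  g-rec-first n = coeffEq λ m → KR.trans (coeff-gPoly-suc n 0 m z≤n) (KR.trans (KR.+-identityʳ _) (KR.sym (coeff-gXD n 0 m)))

  g-rec-middle : ∀ n k → suc k ≤ n → gPoly (suc n) (suc k) ≐ (gXD n (suc k) ⊕X gQ n k)
  g-rec-middle n k k<n = coeffEq λ m → KR.trans (coeff-gPoly-suc n (suc k) m k<n)
    (KR.sym (KR.trans (coeff-⊕K (gXD n (suc k)) (gQ n k) m) (KR.+-cong (coeff-gXD n (suc k) m) (coeff-gQ n k m))))

  -- for k = n+1 only the x^0-coefficient survives, and it is q^n times that of g_n(n)
  g-rec-last : ∀ n → gPoly (suc n) (suc n) ≐ gQ n n
  g-rec-last n = coeffEq λ m → KR.trans (top m) (KR.sym (coeff-gQ n n m))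
    where
    top : ∀ m → gc (suc n) (suc n) m ≈k contribS n (suc n) m
    top m with decide-shape (suc n) (suc n) m
    ... | inj₂ not-shape = KR.trans (coeff-gPoly-off (suc n) (suc n) m NP.≤-refl not-shape)
          (KR.sym (KR.trans (qpow n *K qpow m *≈ coeff-gPoly-off n n m NP.≤-refl (λ j e → not-shape j (shape-k⁺ n m j n e)))
                            (KR.zeroʳ (qpow n *K qpow m))))
    ... | inj₁ (j , e) with shape-top n m j e
    ...   | refl , refl = begin
      gc (suc n) (suc n) 0                         ≈⟨ gc-on (suc n) (suc n) 0 0 e ⟩
      coef 0 0 (suc n)                             ≈⟨ coef-recurrence n 0 0 (suc n) e ⟩
      0K +K 0K +K qpow n *K qpow 0 *K coef 0 0 n   ≈⟨ KR.trans (KR.+-identityʳ 0K ≈+ last) (KR.+-identityˡ last) ⟩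
      qpow n *K qpow 0 *K coef 0 0 n               ≈⟨ qpow n *K qpow 0 *≈ KR.sym (gc-on n n 0 0 refl) ⟩
      qpow n *K qpow 0 *K gc n n 0                 ∎
      where
      last = qpow n *K qpow 0 *K coef 0 0 n


-- By
-- the q-Leibniz rule the factor X + q^n s D_q maps g_n(k) · sDpow f k to
--   gXD n k · sDpow f k + gQ n k · sDpow f (k+1),
-- and by the recurrence of g these terms regroup, over k, into the right-hand
-- side for n+1.
module OperatorIdentity where

  open KAlgebra
  open QNumbers
  open CoefficientRecurrence
  open KPolynomials
  open ClosedForm
  open QDerivative
  open GRecurrence
  open import Data.Nat using (ℕ; zero; suc; _≤_; z≤n; s≤s)
  open import Relation.Binary.PropositionalEquality using (refl)
  open KX using (_≐_; ≐-refl; ≐-sym; ≐-trans) renaming (_⊕_ to _⊕X_; _⊗_ to _⊗X_)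
  open SX using (_⊜_) renaming (_⊕_ to _:+_; _⊗_ to _:*_)

  factorOp-cong : ∀ n {F F'} → F ≐ F' → factorOp n F ≐ factorOp n F'
  factorOp-cong n h = KX.⊕-cong (KX.⊗-congʳ PX.var h) (KX.scale-cong (toK (≈k-refl {powK qK n *K sK})) (Dq-cong h))

  sDpow : KPoly → ℕ → KPoly
  sDpow f k = PX.scale (powK sK k) (DqPow k f)

  factor-on-term : ∀ n f k →
    ((PX.var ⊗X (gPoly n k ⊗X sDpow f k)) ⊕X PX.scale (powK qK n *K sK) (Dq (gPoly n k ⊗X sDpow f k)))
    ≐ ((gXD n k ⊗X sDpow f k) ⊕X (gQ n k ⊗X sDpow f (suc k)))
  factor-on-term n f k = XR.begin
    (PX.var ⊗X (g ⊗X sDpow f k)) ⊕X PX.scale (qpow n *K sK) (Dq (g ⊗X sDpow f k))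
      XR.≈⟨ KX.⊕-cong (KX.⊗-congʳ PX.var (KX.⊗-congʳ g hk))
             (≐-trans (scale-as-⊗ (qpow n *K sK) (Dq (g ⊗X sDpow f k))) (KX.⊗-cong (KX.const-⊗ (qpow n) sK)
                (≐-trans (Dq-Leibniz g (sDpow f k)) (KX.⊕-cong (KX.⊗-congʳ (Dq g) hk)
                   (KX.⊗-congʳ (argScale qK g) (≐-trans (Dq-scale (spow k) (DqPow k f)) (scale-as-⊗ (spow k) (Dq (DqPow k f))))))))) ⟩
    (V ⊗X (g ⊗X (Sk ⊗X Dk))) ⊕X ((Qn ⊗X S) ⊗X ((DG ⊗X (Sk ⊗X Dk)) ⊕X (SG ⊗X (Sk ⊗X DDk))))
      XR.≈⟨ SX.solve 9 (λ V G Sk Dk DDk DG SG Qn S →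
              (V :* (G :* (Sk :* Dk))) :+ ((Qn :* S) :* ((DG :* (Sk :* Dk)) :+ (SG :* (Sk :* DDk))))
              ⊜ ((((V :* G) :+ ((Qn :* S) :* DG)) :* (Sk :* Dk)) :+ ((Qn :* SG) :* ((Sk :* S) :* DDk))))
            ≐-refl V g Sk Dk DDk DG SG Qn S ⟩
    (((V ⊗X g) ⊕X ((Qn ⊗X S) ⊗X DG)) ⊗X (Sk ⊗X Dk)) ⊕X ((Qn ⊗X SG) ⊗X ((Sk ⊗X S) ⊗X DDk))
      XR.≈⟨ ≐-sym (KX.⊕-cong (KX.⊗-cong (KX.⊕-cong (≐-refl {V ⊗X g}) (≐-trans (scale-as-⊗ (qpow n *K sK) DG) (KX.⊗-congˡ DG (KX.const-⊗ (qpow n) sK)))) hk)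
                             (KX.⊗-cong (scale-as-⊗ (qpow n) SG) (≐-trans (scale-as-⊗ (spow k *K sK) DDk) (KX.⊗-congˡ DDk (KX.const-⊗ (spow k) sK))))) ⟩
    (gXD n k ⊗X sDpow f k) ⊕X (gQ n k ⊗X sDpow f (suc k)) XR.∎
    where
    g = gPoly n k
    V = PX.var
    Sk = constX (spow k)
    Dk = DqPow k f
    DDk = Dq Dk
    DG = Dq g
    SG = argScale qK g
    Qn = constX (qpow n)
    S = constX sK
    hk : sDpow f k ≐ (Sk ⊗X Dk)
    hk = scale-as-⊗ (spow k) Dk

  termA : ℕ → KPoly → ℕ → KPoly
  termA n f k = gXD n k ⊗X sDpow f k

  termB : ℕ → KPoly → ℕ → KPoly
  termB n f k = gQ n k ⊗X sDpow f (suc k)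

  termNext : ℕ → KPoly → ℕ → KPoly
  termNext n f k = gPoly (suc n) k ⊗X sDpow f k

  -- Σ_{k≤n} termA k + Σ_{k≤n} termB k = Σ_{k≤n+1} termNext k: pair termA (k+1)
  -- with termB k, and treat k = 0 and k = n+1 apart
  regroup : ∀ n f → (sumTo n (termA n f) ⊕X sumTo n (termB n f)) ≐ sumTo (suc n) (termNext n f)
  regroup zero f = KX.⊕-cong (KX.⊗-congˡ (sDpow f 0) (≐-sym (g-rec-first 0))) (KX.⊗-congˡ (sDpow f 1) (≐-sym (g-rec-last 0)))
  regroup (suc n) f = XR.begin
    sumTo (suc n) (termA N f) ⊕X (sumTo n (termB N f) ⊕X termB N f (suc n))
      XR.≈⟨ KX.⊕-cong (sumTo-first n (termA N f)) (≐-refl {sumTo n (termB N f) ⊕X termB N f (suc n)}) ⟩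
    (a0 ⊕X A') ⊕X (B' ⊕X bN)
      XR.≈⟨ SX.solve 4 (λ a0 A B b → (a0 :+ A) :+ (B :+ b) ⊜ ((a0 :+ (A :+ B)) :+ b)) ≐-refl a0 A' B' bN ⟩
    (a0 ⊕X (A' ⊕X B')) ⊕X bN
      XR.≈⟨ KX.⊕-cong (KX.⊕-cong (KX.⊗-congˡ (sDpow f 0) (≐-sym (g-rec-first N)))
                        (≐-trans (sumTo-⊕ n (λ k → termA N f (suc k)) (termB N f))
                          (sumTo-cong n middle)))
                      (KX.⊗-congˡ (sDpow f (suc N)) (≐-sym (g-rec-last N))) ⟩
    (termNext N f 0 ⊕X sumTo n (λ k → termNext N f (suc k))) ⊕X termNext N f (suc N)
      XR.≈⟨ KX.⊕-cong (≐-sym (sumTo-first n (termNext N f))) (≐-refl {termNext N f (suc N)}) ⟩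
    sumTo (suc N) (termNext N f) XR.∎
    where
    N = suc n
    a0 = termA N f 0
    A' = sumTo n (λ k → termA N f (suc k))
    B' = sumTo n (termB N f)
    bN = termB N f (suc n)
    middle : ∀ k → k ≤ n → (termA N f (suc k) ⊕X termB N f k) ≐ termNext N f (suc k)
    middle k k≤n = ≐-trans (≐-sym (KX.⊗-distribʳ (sDpow f (suc k)) (gXD N (suc k)) (gQ N k)))
                           (KX.⊗-congˡ (sDpow f (suc k)) (≐-sym (g-rec-middle N k (s≤s k≤n))))

  factor-on-rhs : ∀ n f → factorOp n (rhsOp n f) ≐ rhsOp (suc n) f
  factor-on-rhs n f = XR.begin
    (PX.var ⊗X F) ⊕X PX.scale c (Dq F)
      XR.≈⟨ KX.⊕-cong (mul-sumTo PX.var n GH)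
             (≐-trans (KX.scale-cong (toK (≈k-refl {c})) (Dq-sumTo n GH)) (scale-sumTo c n (λ k → Dq (GH k)))) ⟩
    sumTo n (λ k → PX.var ⊗X GH k) ⊕X sumTo n (λ k → PX.scale c (Dq (GH k)))
      XR.≈⟨ sumTo-⊕ n (λ k → PX.var ⊗X GH k) (λ k → PX.scale c (Dq (GH k))) ⟩
    sumTo n (λ k → (PX.var ⊗X GH k) ⊕X PX.scale c (Dq (GH k)))
      XR.≈⟨ sumTo-cong′ n (factor-on-term n f) ⟩
    sumTo n (λ k → termA n f k ⊕X termB n f k)
      XR.≈⟨ ≐-sym (sumTo-⊕ n (termA n f) (termB n f)) ⟩
    sumTo n (termA n f) ⊕X sumTo n (termB n f)
      XR.≈⟨ regroup n f ⟩
    rhsOp (suc n) f XR.∎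
    where
    c = powK qK n *K sK
    GH : ℕ → KPoly
    GH k = gPoly n k ⊗X sDpow f k
    F = rhsOp n f

  gPoly-0-0 : gPoly 0 0 ≐ PX.oneP
  gPoly-0-0 = coeffEq coefficient
    where
    coef-000 : coef 0 0 0 ≈k 1K
    coef-000 = SK.solve 0 (one SK.:* one SK.:* one SK.:* one SK.:* one SK.:* one SK.:* one SK.:* one SK.:* one SK.:= one) ≈k-refl
    coefficient : ∀ m → PX.coeff (gPoly 0 0) m ≈k PX.coeff PX.oneP m
    coefficient zero = KR.trans (gc-on 0 0 0 0 refl) coef-000
    coefficient (suc m) = coeff-gPoly-off 0 0 (suc m) z≤n (λ j ())

  rhs-zero : ∀ f → f ≐ rhsOp 0 f
  rhs-zero f = ≐-sym (≐-trans (KX.⊗-congˡ (PX.scale 1K f) gPoly-0-0) (≐-trans (KX.⊗-identityˡ (PX.scale 1K f)) (KX.scale-1 f)))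

  operator-identity : ∀ n f → lhsOp n f ≐ rhsOp n f
  operator-identity zero f = rhs-zero f
  operator-identity (suc n) f = ≐-trans (factorOp-cong n (operator-identity n f)) (factor-on-rhs n f)

open FractionField using (module KX)
open ClosedForm using (gPoly0≐hPoly)
open OperatorIdentity using (operator-identity)

theorem2 : ((n : ℕ) (f : KPoly) → lhsOp n f ≈X rhsOp n f)
           × ((n : ℕ) → gPoly n 0 ≈X hPoly n)
theorem2 = (λ n f → KX.get (operator-identity n f)) , (λ n → KX.get (gPoly0≐hPoly n))
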